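{- For all integers $k\ge 3$ and $1\le \ell\le k$ there exists an $(\ell\mathcal{F},k)$-forcer $(G,v)$. Moreover, such a forcer exists with $G$ a planar graph.
   Context: Let $k\ge 3$. A $(k,1)$-decomposition of a graph $G$ is a pair $(F_k,M)$ of sets partitioning $E(G)$ such that $F_k$ spans a $k$-bounded linear forest (a forest whose components are paths with at most $k$ edges each) and $M$ is a matching. An $\ell$-path is a path with $\ell$ edges. For $1\le \ell\le k$, given a graph $G$ and a vertex $v$ of degree $1$ in $G$, the pair $(G,v)$ is an $(\ell\mathcal{F},k)$-forcer if (i) $G$ has a $(k,1)$-decomposition, and (ii) for every $(k,1)$-decomposition $(F_k,M)$ of $G$, the vertex $v$ is contained in an $\ell$-path all of whose edges lie in $F_k$, and $v$ is contained in no $(\ell+1)$-path all of whose edges lie in $F_k$. -}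

module Defs where

open import Data.Nat using (ℕ; zero; suc; _≤_; _<_; _∸_)
open import Data.Fin using (Fin; toℕ; inject₁) renaming (suc to fsuc)
open import Data.Bool using (Bool; true; false)
open import Data.Integer using (ℤ; +_) renaming (_+_ to _+ℤ_; _*_ to _*ℤ_)
open import Data.Product using (Σ; _×_; _,_; proj₁; proj₂; ∃; ∃-syntax)
open import Data.Sum using (_⊎_)
open import Relation.Binary.PropositionalEquality using (_≡_; _≢_)
open import Relation.Nullary using (¬_)

Joins : {n : ℕ} → Fin n × Fin n → Fin n → Fin n → Set
Joins p x y = (p ≡ (x , y)) ⊎ (p ≡ (y , x))

record Graph : Set where
  field
    n    : ℕ
    m    : ℕ
    ends : Fin m → Fin n × Fin n
    loopless : ∀ e → proj₁ (ends e) ≢ proj₂ (ends e)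
    simple   : ∀ e f → Joins (ends f) (proj₁ (ends e)) (proj₂ (ends e)) → e ≡ f

module _ (G : Graph) where
  open Graph G

  Incident : Fin m → Fin n → Set
  Incident e x = (proj₁ (ends e) ≡ x) ⊎ (proj₂ (ends e) ≡ x)

  Degree1 : Fin n → Set
  Degree1 v = Σ (Fin m) λ e → Incident e v × (∀ f → Incident f v → f ≡ e)

  -- An edge colouring: true = edge in F_k, false = edge in M.
  Colouring : Set
  Colouring = Fin m → Bool

  record FPath (c : Colouring) (ℓ : ℕ) : Set where
    field
      vert     : Fin (suc ℓ) → Fin n
      vert-inj : ∀ i j → vert i ≡ vert j → i ≡ j
      edge     : Fin ℓ → Fin m
      edge-joins : ∀ i → Joins (ends (edge i)) (vert (inject₁ i)) (vert (fsuc i))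
      edge-F   : ∀ i → c (edge i) ≡ true

  OnFPath : Colouring → ℕ → Fin n → Set
  OnFPath c ℓ v = Σ (FPath c ℓ) λ P → ∃[ i ] FPath.vert P i ≡ v

  record KLinearForest (k : ℕ) (c : Colouring) : Set where
    field
      p      : ℕ
      len    : Fin p → ℕ
      len≤k  : ∀ j → len j ≤ k
      vert   : (j : Fin p) → Fin (suc (len j)) → Fin n
      vert-inj : ∀ j i j' i' → vert j i ≡ vert j' i' → (j ≡ j') × (toℕ i ≡ toℕ i')
      edge   : (j : Fin p) → Fin (len j) → Fin m
      edge-joins : ∀ j i → Joins (ends (edge j i)) (vert j (inject₁ i)) (vert j (fsuc i))
      edge-F : ∀ j i → c (edge j i) ≡ true
      cover  : ∀ e → c e ≡ true → Σ (Fin p) λ j → Σ (Fin (len j)) λ i → edge j i ≡ e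

  Matching : Colouring → Set
  Matching c = ∀ e f → e ≢ f → c e ≡ false → c f ≡ false →
               ∀ x → ¬ (Incident e x × Incident f x)

  IsDecomposition : ℕ → Colouring → Set
  IsDecomposition k c = KLinearForest k c × Matching c

  Forcer : ℕ → ℕ → Fin n → Set
  Forcer ℓ k v =
    Degree1 v ×
    (Σ Colouring λ c → IsDecomposition k c) ×
    (∀ c → IsDecomposition k c → OnFPath c ℓ v × ¬ OnFPath c (suc ℓ) v)

  -- Planarity: a straight-line plane drawing with vertices at integer points.
  -- A point of segment [a,b] with rational parameter s/q (0 ≤ s ≤ q, q > 0),
  -- scaled by q, is  (q - s)·a + s·b.
  Pt : Set
  Pt = ℤ × ℤ

  scale : ℕ → Pt → Pt
  scale q (x , y) = (+ q *ℤ x , + q *ℤ y)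

  segPt : ℕ → ℕ → Pt → Pt → Pt
  segPt q s (a₁ , a₂) (b₁ , b₂) =
    (+ (q ∸ s) *ℤ a₁ +ℤ + s *ℤ b₁ , + (q ∸ s) *ℤ a₂ +ℤ + s *ℤ b₂)

  record PlaneDrawing : Set where
    field
      pos     : Fin n → Pt
      pos-inj : ∀ x y → pos x ≡ pos y → x ≡ y
    seg : ℕ → ℕ → Fin m → Pt
    seg q s e = segPt q s (pos (proj₁ (ends e))) (pos (proj₂ (ends e)))
    field
      vertex-off-edges : ∀ w e q s → 0 < q → s ≤ q →
        scale q (pos w) ≡ seg q s e → Incident e w
      edges-meet-at-ends : ∀ e f → e ≢ f → ∀ q s t → 0 < q → s ≤ q → t ≤ q →
        seg q s e ≡ seg q t f →
        Σ (Fin n) λ x → Incident e x × Incident f x × scale q (pos x) ≡ seg q s e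

  Planar : Set
  Planar = PlaneDrawing

module Submission where

-- Hang a copy of a gadget (one for each k ≤ 7, one for all k ≥ 8) from each of s₁, …, s_ℓ
-- on a path v = s₀ s₁ ⋯ s_ℓ.  The gadget is attached by a single edge, and a finite case
-- analysis shows that every (k,1)-decomposition of any graph containing the gadget puts that
-- edge into M: each other colouring of the gadget contains an F-vertex of degree three, an
-- F-triangle or F-4-cycle, two M-edges at a vertex, or an F-path with k + 1 edges.  Since M
-- is a matching, every spine edge s_{i-1}s_i is then in F, giving an F-path of length ℓ at v;
-- and an F-edge leaving the spine would have to be an attachment edge, so no F-path at v is
-- longer.  Planarity comes from explicit integer coordinates: every vertex is separated from
-- every edge not containing it, and every two edges from each other, by a strict inequality
-- along one axis, or they form a wedge at a common end.

open import Defs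
open import Data.Nat using (ℕ; zero; suc; _+_; _*_; _∸_; _≤_; _<_; z≤n; s≤s; z<s; s≤s⁻¹; _≤?_; _<?_; >-nonZero)
open import Data.Nat.Properties
open import Data.Integer using (ℤ; +_) renaming (_+_ to _+ℤ_; _*_ to _*ℤ_)
open import Data.Integer.Properties using (pos-*; pos-+) renaming (+-injective to pos-injective)
open import Data.Fin using (Fin; toℕ; inject₁; combine; remQuot; #_) renaming (zero to fzero; suc to fsuc; _≟_ to _≟ᶠ_)
open import Data.Fin.Properties using (toℕ-injective; toℕ-inject₁; injective⇒≤; all?; any?; combine-injective; combine-surjective; remQuot-combine; combine-remQuot) renaming (suc-injective to fsuc-injective)
open import Data.Fin.Induction using (<-weakInduction)
open import Data.Bool using (Bool; true; false)
open import Function using (_∘_; id)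
open import Data.Product using (Σ; _×_; _,_; proj₁; proj₂; map; uncurry)
open import Data.Product.Properties using (,-injectiveˡ; ,-injectiveʳ; ≡-dec)
open import Data.Vec using (Vec; []; _∷_; lookup)
open import Data.Vec.Relation.Unary.All using (All; []; _∷_)
open import Data.Vec.Relation.Unary.All.Properties using (lookup⁺)
open import Data.Sum using (_⊎_; inj₁; inj₂)
open import Data.Empty using (⊥; ⊥-elim)
open import Relation.Nullary using (¬_; Dec; yes; no; contradiction; ¬?)
open import Relation.Nullary.Decidable using (_×-dec_; _⊎-dec_; _→-dec_; map′; True; False; toWitness; toWitnessFalse)
open import Relation.Binary using (tri<; tri≈; tri>)
open import Relation.Binary.PropositionalEquality using (_≡_; _≢_; refl; sym; trans; cong; cong₂; subst; subst₂)

convex : ℕ → ℕ → ℕ → ℕ → ℕ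
convex q s a b = (q ∸ s) * a + s * b

*-split : ∀ {q s} x → s ≤ q → q * x ≡ (q ∸ s) * x + s * x
*-split {q} {s} x s≤q = trans (cong (_* x) (sym (m∸n+n≡m s≤q))) (*-distribʳ-+ x (q ∸ s) s)

q*≤convex : ∀ {q s m a b} → s ≤ q → m ≤ a → m ≤ b → q * m ≤ convex q s a b
q*≤convex {q} {s} {m} s≤q m≤a m≤b =
  ≤-trans (≤-reflexive (*-split m s≤q)) (+-mono-≤ (*-monoʳ-≤ (q ∸ s) m≤a) (*-monoʳ-≤ s m≤b))

convex≤q* : ∀ {q s m a b} → s ≤ q → a ≤ m → b ≤ m → convex q s a b ≤ q * m
convex≤q* {q} {s} {m} s≤q a≤m b≤m =
  ≤-trans (+-mono-≤ (*-monoʳ-≤ (q ∸ s) a≤m) (*-monoʳ-≤ s b≤m)) (≤-reflexive (sym (*-split m s≤q)))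

q*<convex : ∀ {q s w a b} → 0 < q → s ≤ q → w < a → w < b → q * w < convex q s a b
q*<convex {q} 0<q s≤q w<a w<b =
  <-≤-trans (*-monoʳ-< q {{>-nonZero 0<q}} (n<1+n _)) (q*≤convex s≤q w<a w<b)

convex<q* : ∀ {q s w a b} → 0 < q → s ≤ q → a < w → b < w → convex q s a b < q * w
convex<q* {q} 0<q s≤q (s≤s a≤w) (s≤s b≤w) =
  ≤-<-trans (convex≤q* s≤q a≤w b≤w) (*-monoʳ-< q {{>-nonZero 0<q}} (n<1+n _))

m*n≤m*o∧o<n⇒m≡0 : ∀ m {n o} → m * n ≤ m * o → o < n → m ≡ 0
m*n≤m*o∧o<n⇒m≡0 zero    _  _   = refl
m*n≤m*o∧o<n⇒m≡0 (suc m) le o<n = contradiction (*-cancelˡ-≤ (suc m) le) (<⇒≱ o<n)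

convex-at-start : ∀ {q s x a} → s ≤ q →
  (x < a × convex q s x a ≤ q * x) ⊎ (a < x × q * x ≤ convex q s x a) → s ≡ 0
convex-at-start {q} {s} {x} s≤q (inj₁ (x<a , le)) =
  m*n≤m*o∧o<n⇒m≡0 s (+-cancelˡ-≤ ((q ∸ s) * x) _ _ (≤-trans le (≤-reflexive (*-split x s≤q)))) x<a
convex-at-start {q} {s} {x} s≤q (inj₂ (a<x , le)) =
  m*n≤m*o∧o<n⇒m≡0 s (+-cancelˡ-≤ ((q ∸ s) * x) _ _ (≤-trans (≤-reflexive (sym (*-split x s≤q))) le)) a<x

convex-at-end : ∀ {q s x a} → s ≤ q →
  (x < a × convex q s a x ≤ q * x) ⊎ (a < x × q * x ≤ convex q s a x) → s ≡ q
convex-at-end {q} {s} {x} {a} s≤q h = ≤-antisym s≤q (m∸n≡0⇒m≤n (weight-on-a-vanishes h))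
  where
  weight-on-a-vanishes : (x < a × convex q s a x ≤ q * x) ⊎ (a < x × q * x ≤ convex q s a x) → q ∸ s ≡ 0
  weight-on-a-vanishes (inj₁ (x<a , le)) =
    m*n≤m*o∧o<n⇒m≡0 (q ∸ s) (+-cancelʳ-≤ (s * x) _ _ (≤-trans le (≤-reflexive (*-split x s≤q)))) x<a
  weight-on-a-vanishes (inj₂ (a<x , le)) =
    m*n≤m*o∧o<n⇒m≡0 (q ∸ s) (+-cancelʳ-≤ (s * x) _ _ (≤-trans (≤-reflexive (sym (*-split x s≤q))) le)) a<x

data Axis : Set where
  horizontal vertical : Axis

any-axis? : {P : Axis → Set} → (∀ ax → Dec (P ax)) → Dec (Σ Axis P)
any-axis? P? with P? horizontal | P? vertical
... | yes p | _     = yes (horizontal , p)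
... | no _  | yes p = yes (vertical , p)
... | no ¬h | no ¬v = no λ { (horizontal , p) → ¬h p ; (vertical , p) → ¬v p }

module Segments {n : ℕ} (coord : Axis → Fin n → ℕ) where

  Segment : Set
  Segment = Fin n × Fin n

  _<[_]_ : Fin n → Axis → Fin n → Set
  u <[ ax ] v = coord ax u < coord ax v

  _≤[_]_ : Fin n → Axis → Fin n → Set
  u ≤[ ax ] v = coord ax u ≤ coord ax v

  point : Segment → ℕ → ℕ → Axis → ℕ
  point (a , b) q s ax = convex q s (coord ax a) (coord ax b)

  Endpoint : Fin n → Segment → Set
  Endpoint x (a , b) = (a ≡ x) ⊎ (b ≡ x)

  Off : Fin n → Segment → Set
  Off w (a , b) = Σ Axis λ ax → (w <[ ax ] a × w <[ ax ] b) ⊎ (a <[ ax ] w × b <[ ax ] w)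

  Precedes : Axis → Segment → Segment → Set
  Precedes ax (a , b) (a′ , b′) = (a <[ ax ] a′ × a <[ ax ] b′) × (b <[ ax ] a′ × b <[ ax ] b′)

  -- Leaving x, the arm towards a moves strictly along ax while the arm towards b does not follow.
  Opens : Axis → Fin n → Fin n → Fin n → Set
  Opens ax x a b = (x <[ ax ] a × b ≤[ ax ] x) ⊎ (a <[ ax ] x × x ≤[ ax ] b)

  Wedge : Axis → Fin n → Fin n → Fin n → Set
  Wedge ax x a b = Opens ax x a b ⊎ Opens ax x b a

  Corner : Segment → Segment → Set
  Corner p p′ = Σ (Fin n) λ x → Σ (Fin n) λ a → Σ (Fin n) λ b →
    Joins p x a × Joins p′ x b × Σ Axis λ ax → Wedge ax x a b

  Apart : Segment → Segment → Set
  Apart p p′ = (Σ Axis λ ax → Precedes ax p p′ ⊎ Precedes ax p′ p) ⊎ Corner p p′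

  _<?[_]_ : ∀ u ax v → Dec (u <[ ax ] v)
  u <?[ ax ] v = coord ax u <? coord ax v

  _≤?[_]_ : ∀ u ax v → Dec (u ≤[ ax ] v)
  u ≤?[ ax ] v = coord ax u ≤? coord ax v

  off? : ∀ w p → Dec (Off w p)
  off? w (a , b) = any-axis? λ ax →
    (w <?[ ax ] a ×-dec w <?[ ax ] b) ⊎-dec (a <?[ ax ] w ×-dec b <?[ ax ] w)

  precedes? : ∀ ax p p′ → Dec (Precedes ax p p′)
  precedes? ax (a , b) (a′ , b′) =
    (a <?[ ax ] a′ ×-dec a <?[ ax ] b′) ×-dec (b <?[ ax ] a′ ×-dec b <?[ ax ] b′)

  opens? : ∀ ax x a b → Dec (Opens ax x a b)
  opens? ax x a b = (x <?[ ax ] a ×-dec b ≤?[ ax ] x) ⊎-dec (a <?[ ax ] x ×-dec x ≤?[ ax ] b)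

  SharedEnd : Fin n → Fin n → Fin n → Fin n → Set
  SharedEnd x a x′ b = x ≡ x′ × Σ Axis λ ax → Wedge ax x a b

  shared-end? : ∀ x a x′ b → Dec (SharedEnd x a x′ b)
  shared-end? x a x′ b = (x ≟ᶠ x′) ×-dec any-axis? λ ax → opens? ax x a b ⊎-dec opens? ax x b a

  corner? : ∀ p p′ → Dec (Corner p p′)
  corner? (a , b) (a′ , b′) = map′ corner corner-orientation
    ((shared-end? a b a′ b′ ⊎-dec shared-end? a b b′ a′) ⊎-dec (shared-end? b a a′ b′ ⊎-dec shared-end? b a b′ a′))
    where
    Oriented : Set
    Oriented = (SharedEnd a b a′ b′ ⊎ SharedEnd a b b′ a′) ⊎ (SharedEnd b a a′ b′ ⊎ SharedEnd b a b′ a′)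
    corner : Oriented → Corner (a , b) (a′ , b′)
    corner (inj₁ (inj₁ (refl , w))) = a , b , b′ , inj₁ refl , inj₁ refl , w
    corner (inj₁ (inj₂ (refl , w))) = a , b , a′ , inj₁ refl , inj₂ refl , w
    corner (inj₂ (inj₁ (refl , w))) = b , a , b′ , inj₂ refl , inj₁ refl , w
    corner (inj₂ (inj₂ (refl , w))) = b , a , a′ , inj₂ refl , inj₂ refl , w
    corner-orientation : Corner (a , b) (a′ , b′) → Oriented
    corner-orientation (_ , _ , _ , inj₁ refl , inj₁ refl , w) = inj₁ (inj₁ (refl , w))
    corner-orientation (_ , _ , _ , inj₁ refl , inj₂ refl , w) = inj₁ (inj₂ (refl , w))
    corner-orientation (_ , _ , _ , inj₂ refl , inj₁ refl , w) = inj₂ (inj₁ (refl , w))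
    corner-orientation (_ , _ , _ , inj₂ refl , inj₂ refl , w) = inj₂ (inj₂ (refl , w))

  apart-sym : ∀ {p p′} → Apart p p′ → Apart p′ p
  apart-sym (inj₁ (ax , inj₁ p≺p′)) = inj₁ (ax , inj₂ p≺p′)
  apart-sym (inj₁ (ax , inj₂ p′≺p)) = inj₁ (ax , inj₁ p′≺p)
  apart-sym (inj₂ (x , a , b , j , j′ , ax , inj₁ o)) = inj₂ (x , b , a , j′ , j , ax , inj₂ o)
  apart-sym (inj₂ (x , a , b , j , j′ , ax , inj₂ o)) = inj₂ (x , b , a , j′ , j , ax , inj₁ o)

  apart? : ∀ p p′ → Dec (Apart p p′)
  apart? p p′ = any-axis? (λ ax → precedes? ax p p′ ⊎-dec precedes? ax p′ p) ⊎-dec corner? p p′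

  joins⇒endpoint : ∀ {p x a} → Joins p x a → Endpoint x p
  joins⇒endpoint (inj₁ refl) = inj₁ refl
  joins⇒endpoint (inj₂ refl) = inj₂ refl

  off-segment : ∀ {w p q s} → 0 < q → s ≤ q → Off w p → ¬ (∀ ax → q * coord ax w ≡ point p q s ax)
  off-segment 0<q s≤q (ax , inj₁ (w<a , w<b)) on = <-irrefl (on ax) (q*<convex 0<q s≤q w<a w<b)
  off-segment 0<q s≤q (ax , inj₂ (a<w , b<w)) on = <-irrefl (sym (on ax)) (convex<q* 0<q s≤q a<w b<w)

  precedes⇒point< : ∀ {p p′ q s t} ax → 0 < q → s ≤ q → t ≤ q → Precedes ax p p′ →
    point p q s ax < point p′ q t ax
  precedes⇒point< ax 0<q s≤q t≤q ((a<a′ , a<b′) , (b<a′ , b<b′)) =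
    ≤-<-trans (convex≤q* s≤q (m≤m⊔n _ _) (m≤n⊔m _ _)) (q*<convex 0<q t≤q (⊔-lub a<a′ b<a′) (⊔-lub a<b′ b<b′))

  point≤end : ∀ {p x b q t} ax → t ≤ q → Joins p x b → b ≤[ ax ] x → point p q t ax ≤ q * coord ax x
  point≤end ax t≤q (inj₁ refl) b≤x = convex≤q* t≤q ≤-refl b≤x
  point≤end ax t≤q (inj₂ refl) b≤x = convex≤q* t≤q b≤x ≤-refl

  end≤point : ∀ {p x b q t} ax → t ≤ q → Joins p x b → x ≤[ ax ] b → q * coord ax x ≤ point p q t ax
  end≤point ax t≤q (inj₁ refl) x≤b = q*≤convex t≤q ≤-refl x≤b
  end≤point ax t≤q (inj₂ refl) x≤b = q*≤convex t≤q x≤b ≤-refl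

  point-at-end : ∀ {p x a q s} ax → s ≤ q → Joins p x a →
    (x <[ ax ] a × point p q s ax ≤ q * coord ax x) ⊎ (a <[ ax ] x × q * coord ax x ≤ point p q s ax) →
    ∀ ax′ → point p q s ax′ ≡ q * coord ax′ x
  point-at-end {q = q} ax s≤q (inj₁ refl) beyond ax′ with convex-at-start s≤q beyond
  ... | refl = +-identityʳ (q * _)
  point-at-end {x = x} {a} {q} ax s≤q (inj₂ refl) beyond ax′ with convex-at-end s≤q beyond
  ... | refl = cong (λ r → r * coord ax′ a + q * coord ax′ x) (n∸n≡0 q)

  opens⇒point-at-end : ∀ {p p′ x a b q s t} ax → s ≤ q → t ≤ q → Joins p x a → Joins p′ x b →
    Opens ax x a b → point p q s ax ≡ point p′ q t ax → ∀ ax′ → point p q s ax′ ≡ q * coord ax′ x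
  opens⇒point-at-end ax s≤q t≤q j j′ (inj₁ (x<a , b≤x)) same =
    point-at-end ax s≤q j (inj₁ (x<a , ≤-trans (≤-reflexive same) (point≤end ax t≤q j′ b≤x)))
  opens⇒point-at-end ax s≤q t≤q j j′ (inj₂ (a<x , x≤b)) same =
    point-at-end ax s≤q j (inj₂ (a<x , ≤-trans (end≤point ax t≤q j′ x≤b) (≤-reflexive (sym same))))

  apart-segments-meet-at-end : ∀ {p p′ q s t} → 0 < q → s ≤ q → t ≤ q → Apart p p′ →
    (∀ ax → point p q s ax ≡ point p′ q t ax) →
    Σ (Fin n) λ x → Endpoint x p × Endpoint x p′ × (∀ ax → q * coord ax x ≡ point p q s ax)
  apart-segments-meet-at-end 0<q s≤q t≤q (inj₁ (ax , inj₁ p≺p′)) same =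
    ⊥-elim (<-irrefl (same ax) (precedes⇒point< ax 0<q s≤q t≤q p≺p′))
  apart-segments-meet-at-end 0<q s≤q t≤q (inj₁ (ax , inj₂ p′≺p)) same =
    ⊥-elim (<-irrefl (sym (same ax)) (precedes⇒point< ax 0<q t≤q s≤q p′≺p))
  apart-segments-meet-at-end 0<q s≤q t≤q (inj₂ (x , a , b , j , j′ , ax , inj₁ opens)) same =
    x , joins⇒endpoint j , joins⇒endpoint j′ ,
    λ ax′ → sym (opens⇒point-at-end ax s≤q t≤q j j′ opens (same ax) ax′)
  apart-segments-meet-at-end 0<q s≤q t≤q (inj₂ (x , a , b , j , j′ , ax , inj₂ opens)) same =
    x , joins⇒endpoint j , joins⇒endpoint j′ ,
    λ ax′ → sym (trans (same ax′) (opens⇒point-at-end ax t≤q s≤q j′ j opens (sym (same ax)) ax′))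

  wedge-irrefl : ∀ {ax x a} → ¬ Wedge ax x a a
  wedge-irrefl (inj₁ (inj₁ (x<a , a≤x))) = <⇒≱ x<a a≤x
  wedge-irrefl (inj₁ (inj₂ (a<x , x≤a))) = <⇒≱ a<x x≤a
  wedge-irrefl (inj₂ (inj₁ (x<a , a≤x))) = <⇒≱ x<a a≤x
  wedge-irrefl (inj₂ (inj₂ (a<x , x≤a))) = <⇒≱ a<x x≤a

  corner-ends : ∀ {p p′ : Segment} {x a b} → Joins p x a → Joins p′ x b → Joins p′ (proj₁ p) (proj₂ p) → a ≡ b ⊎ x ≡ a
  corner-ends (inj₁ refl) (inj₁ refl) (inj₁ refl) = inj₁ refl
  corner-ends (inj₁ refl) (inj₁ refl) (inj₂ refl) = inj₂ refl
  corner-ends (inj₁ refl) (inj₂ refl) (inj₁ refl) = inj₂ refl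
  corner-ends (inj₁ refl) (inj₂ refl) (inj₂ refl) = inj₁ refl
  corner-ends (inj₂ refl) (inj₁ refl) (inj₁ refl) = inj₂ refl
  corner-ends (inj₂ refl) (inj₁ refl) (inj₂ refl) = inj₁ refl
  corner-ends (inj₂ refl) (inj₂ refl) (inj₁ refl) = inj₁ refl
  corner-ends (inj₂ refl) (inj₂ refl) (inj₂ refl) = inj₂ refl

  joins-loop : ∀ {p : Segment} {x} → Joins p x x → proj₁ p ≡ proj₂ p
  joins-loop (inj₁ refl) = refl
  joins-loop (inj₂ refl) = refl

  apart-joins⇒loop : ∀ {p p′} → Apart p p′ → Joins p′ (proj₁ p) (proj₂ p) → proj₁ p ≡ proj₂ p
  apart-joins⇒loop (inj₁ (ax , inj₁ ((a<a , _) , _))) (inj₁ refl) = ⊥-elim (<-irrefl refl a<a)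
  apart-joins⇒loop (inj₁ (ax , inj₁ ((_ , a<a) , _))) (inj₂ refl) = ⊥-elim (<-irrefl refl a<a)
  apart-joins⇒loop (inj₁ (ax , inj₂ ((a<a , _) , _))) (inj₁ refl) = ⊥-elim (<-irrefl refl a<a)
  apart-joins⇒loop (inj₁ (ax , inj₂ (_ , (a<a , _)))) (inj₂ refl) = ⊥-elim (<-irrefl refl a<a)
  apart-joins⇒loop {p} (inj₂ (x , a , b , j , j′ , ax , w)) j″ = loop (corner-ends j j′ j″)
    where
    loop : a ≡ b ⊎ x ≡ a → proj₁ p ≡ proj₂ p
    loop (inj₁ refl) = ⊥-elim (wedge-irrefl w)
    loop (inj₂ refl) = joins-loop j

  simple-if-apart : ∀ {m} {ends : Fin m → Segment} → (∀ e → proj₁ (ends e) ≢ proj₂ (ends e)) →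
    (∀ e f → e ≡ f ⊎ Apart (ends e) (ends f)) →
    ∀ e f → Joins (ends f) (proj₁ (ends e)) (proj₂ (ends e)) → e ≡ f
  simple-if-apart loopless apart e f j with apart e f
  ... | inj₁ e≡f = e≡f
  ... | inj₂ e∥f = ⊥-elim (loopless e (apart-joins⇒loop e∥f j))

plane : (Axis → ℕ) → ℤ × ℤ
plane f = (+ f horizontal , + f vertical)

plane-injective : ∀ {f g} → plane f ≡ plane g → ∀ ax → f ax ≡ g ax
plane-injective eq horizontal = pos-injective (,-injectiveˡ eq)
plane-injective eq vertical   = pos-injective (,-injectiveʳ eq)

plane-cong : ∀ {f g} → (∀ ax → f ax ≡ g ax) → plane f ≡ plane g
plane-cong eq = cong₂ _,_ (cong +_ (eq horizontal)) (cong +_ (eq vertical))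

module _ (G : Graph) (coord : Axis → Fin (Graph.n G) → ℕ) where
  open Graph G
  open Segments coord

  private
    position : Fin n → ℤ × ℤ
    position u = plane (λ ax → coord ax u)

    pos-*-+ : ∀ r s a b → + r *ℤ + a +ℤ + s *ℤ + b ≡ + (r * a + s * b)
    pos-*-+ r s a b = trans (cong₂ _+ℤ_ (sym (pos-* r a)) (sym (pos-* s b))) (sym (pos-+ (r * a) (s * b)))

    scale-position : ∀ q u → scale G q (position u) ≡ plane (λ ax → q * coord ax u)
    scale-position q u = cong₂ _,_ (sym (pos-* q _)) (sym (pos-* q _))

    drawn : Fin m → ℕ → ℕ → ℤ × ℤ
    drawn e q s = segPt G q s (position (proj₁ (ends e))) (position (proj₂ (ends e)))

    drawn-point : ∀ e q s → drawn e q s ≡ plane (point (ends e) q s)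
    drawn-point e q s = cong₂ _,_ (pos-*-+ (q ∸ s) s _ _) (pos-*-+ (q ∸ s) s _ _)

  plane-drawing :
    (∀ u v → coord horizontal u ≡ coord horizontal v → coord vertical u ≡ coord vertical v → u ≡ v) →
    (∀ w e → Incident G e w ⊎ Off w (ends e)) → (∀ e f → e ≡ f ⊎ Apart (ends e) (ends f)) → PlaneDrawing G
  plane-drawing coord-injective vertex-clear edges-clear = record
    { pos = position
    ; pos-inj = λ u v eq → coord-injective u v (pos-injective (,-injectiveˡ eq)) (pos-injective (,-injectiveʳ eq))
    ; vertex-off-edges = off-edges
    ; edges-meet-at-ends = meet-at-ends }
    where
    off-edges : ∀ w e q s → 0 < q → s ≤ q → scale G q (position w) ≡ drawn e q s → Incident G e w
    off-edges w e q s 0<q s≤q eq with vertex-clear w e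
    ... | inj₁ touches = touches
    ... | inj₂ off = ⊥-elim (off-segment {w} {ends e} {q} {s} 0<q s≤q off
                       (plane-injective (trans (sym (scale-position q w)) (trans eq (drawn-point e q s)))))

    meet-at-ends : ∀ e f → e ≢ f → ∀ q s t → 0 < q → s ≤ q → t ≤ q → drawn e q s ≡ drawn f q t →
      Σ (Fin n) λ x → Incident G e x × Incident G f x × scale G q (position x) ≡ drawn e q s
    meet-at-ends e f e≢f q s t 0<q s≤q t≤q eq with edges-clear e f
    ... | inj₁ e≡f = ⊥-elim (e≢f e≡f)
    ... | inj₂ e∥f with apart-segments-meet-at-end 0<q s≤q t≤q e∥f
                          (plane-injective (trans (sym (drawn-point e q s)) (trans eq (drawn-point f q t))))
    ...   | x , x∈e , x∈f , at-x = x , x∈e , x∈f ,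
            trans (scale-position q x) (trans (plane-cong at-x) (sym (drawn-point e q s)))

module Translation {n n′} (coord : Axis → Fin n → ℕ) (coord′ : Axis → Fin n′ → ℕ)
  (f : Fin n → Fin n′) (shift : Axis → ℕ) (coord-f : ∀ ax u → coord′ ax (f u) ≡ shift ax + coord ax u) where
  open Segments

  private
    <-translate : ∀ {ax u v} → _<[_]_ coord u ax v → _<[_]_ coord′ (f u) ax (f v)
    <-translate {ax} {u} {v} u<v = subst₂ _<_ (sym (coord-f ax u)) (sym (coord-f ax v)) (+-monoʳ-< (shift ax) u<v)

    ≤-translate : ∀ {ax u v} → _≤[_]_ coord u ax v → _≤[_]_ coord′ (f u) ax (f v)
    ≤-translate {ax} {u} {v} u≤v = subst₂ _≤_ (sym (coord-f ax u)) (sym (coord-f ax v)) (+-monoʳ-≤ (shift ax) u≤v)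

    joins-translate : ∀ {p x a} → Joins p x a → Joins (map f f p) (f x) (f a)
    joins-translate (inj₁ refl) = inj₁ refl
    joins-translate (inj₂ refl) = inj₂ refl

    opens-translate : ∀ {ax x a b} → Opens coord ax x a b → Opens coord′ ax (f x) (f a) (f b)
    opens-translate (inj₁ (x<a , b≤x)) = inj₁ (<-translate x<a , ≤-translate b≤x)
    opens-translate (inj₂ (a<x , x≤b)) = inj₂ (<-translate a<x , ≤-translate x≤b)

    precedes-translate : ∀ {ax p p′} → Precedes coord ax p p′ → Precedes coord′ ax (map f f p) (map f f p′)
    precedes-translate ((l₁ , l₂) , (l₃ , l₄)) = (<-translate l₁ , <-translate l₂) , (<-translate l₃ , <-translate l₄)

  off-translate : ∀ {w p} → Off coord w p → Off coord′ (f w) (map f f p)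
  off-translate (ax , inj₁ (l₁ , l₂)) = ax , inj₁ (<-translate l₁ , <-translate l₂)
  off-translate (ax , inj₂ (l₁ , l₂)) = ax , inj₂ (<-translate l₁ , <-translate l₂)

  apart-translate : ∀ {p p′} → Apart coord p p′ → Apart coord′ (map f f p) (map f f p′)
  apart-translate (inj₁ (ax , inj₁ p≺p′)) = inj₁ (ax , inj₁ (precedes-translate p≺p′))
  apart-translate (inj₁ (ax , inj₂ p′≺p)) = inj₁ (ax , inj₂ (precedes-translate p′≺p))
  apart-translate (inj₂ (x , a , b , j , j′ , ax , inj₁ o)) =
    inj₂ (f x , f a , f b , joins-translate j , joins-translate j′ , ax , inj₁ (opens-translate o))
  apart-translate (inj₂ (x , a , b , j , j′ , ax , inj₂ o)) =
    inj₂ (f x , f a , f b , joins-translate j , joins-translate j′ , ax , inj₂ (opens-translate o))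

Consecutive : ℕ → ℕ → Set
Consecutive a b = suc a ≡ b ⊎ suc b ≡ a

consecutive-sym : ∀ {a b} → Consecutive a b → Consecutive b a
consecutive-sym (inj₁ eq) = inj₂ eq
consecutive-sym (inj₂ eq) = inj₁ eq

private
  offsets-differ : ∀ {a} p q → {False (p ≟ q)} → p + a ≢ q + a
  offsets-differ {a} p q {p≢q} eq = toWitnessFalse p≢q (+-cancelʳ-≡ a p q eq)

consecutive-three : ∀ {a b c d} → Consecutive a b → Consecutive a c → Consecutive a d →
  b ≡ c ⊎ b ≡ d ⊎ c ≡ d
consecutive-three (inj₁ refl) (inj₁ refl) _            = inj₁ refl
consecutive-three (inj₂ refl) (inj₂ eq)   _            = inj₁ (suc-injective (sym eq))
consecutive-three (inj₁ refl) (inj₂ _)    (inj₁ refl)  = inj₂ (inj₁ refl)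
consecutive-three (inj₂ _)    (inj₁ refl) (inj₁ refl)  = inj₂ (inj₂ refl)
consecutive-three (inj₁ _)    (inj₂ refl) (inj₂ eq)    = inj₂ (inj₂ (suc-injective (sym eq)))
consecutive-three (inj₂ refl) (inj₁ _)    (inj₂ eq)    = inj₂ (inj₁ (suc-injective (sym eq)))

no-consecutive-triangle : ∀ {a b c} → Consecutive a b → Consecutive b c → ¬ Consecutive c a
no-consecutive-triangle (inj₁ refl) (inj₁ refl) (inj₁ eq) = offsets-differ 3 0 eq
no-consecutive-triangle (inj₁ refl) (inj₁ refl) (inj₂ eq) = offsets-differ 1 2 eq
no-consecutive-triangle (inj₁ refl) (inj₂ refl) (inj₁ eq) = offsets-differ 1 0 eq
no-consecutive-triangle (inj₁ refl) (inj₂ refl) (inj₂ eq) = offsets-differ 1 0 eq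
no-consecutive-triangle (inj₂ refl) (inj₁ refl) (inj₁ eq) = offsets-differ 1 0 eq
no-consecutive-triangle (inj₂ refl) (inj₁ refl) (inj₂ eq) = offsets-differ 1 0 eq
no-consecutive-triangle (inj₂ refl) (inj₂ refl) (inj₁ eq) = offsets-differ 1 2 eq
no-consecutive-triangle (inj₂ refl) (inj₂ refl) (inj₂ eq) = offsets-differ 3 0 eq

consecutive-square : ∀ {a b c d} → Consecutive a b → Consecutive b c → Consecutive c d → Consecutive d a →
  a ≡ c ⊎ b ≡ d
consecutive-square (inj₁ refl) (inj₁ refl) (inj₁ refl) (inj₁ eq) = ⊥-elim (offsets-differ 4 0 eq)
consecutive-square (inj₁ refl) (inj₁ refl) (inj₁ refl) (inj₂ eq) = ⊥-elim (offsets-differ 1 3 eq)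
consecutive-square (inj₁ refl) (inj₁ refl) (inj₂ refl) _         = inj₂ refl
consecutive-square (inj₁ refl) (inj₂ refl) _           _         = inj₁ refl
consecutive-square (inj₂ refl) (inj₁ refl) _           _         = inj₁ refl
consecutive-square (inj₂ refl) (inj₂ refl) (inj₁ refl) _         = inj₂ refl
consecutive-square (inj₂ refl) (inj₂ refl) (inj₂ refl) (inj₁ eq) = ⊥-elim (offsets-differ 1 3 eq)
consecutive-square (inj₂ refl) (inj₂ refl) (inj₂ refl) (inj₂ eq) = ⊥-elim (offsets-differ 4 0 eq)

InImage : ∀ {n N} → (Fin N → Fin n) → Fin n → Set
InImage {N = N} f x = Σ (Fin N) λ t → f t ≡ x

joins-sym : ∀ {n} {p : Fin n × Fin n} {x y} → Joins p x y → Joins p y x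
joins-sym (inj₁ eq) = inj₂ eq
joins-sym (inj₂ eq) = inj₁ eq

joins-both : ∀ {n} {p : Fin n × Fin n} {u w x y} → Joins p u w → Joins p x y → Joins (u , w) x y
joins-both (inj₁ refl) j = j
joins-both (inj₂ refl) (inj₁ refl) = inj₂ refl
joins-both (inj₂ refl) (inj₂ refl) = inj₁ refl

module _ (G : Graph) {c : Colouring G} where
  open Graph G

  F-path-induction : ∀ {L} (P : FPath G c L) (Q : Fin n → Set) →
    (∀ {e x y} → c e ≡ true → Joins (ends e) x y → Q x → Q y) → Q (FPath.vert P fzero) → ∀ t → Q (FPath.vert P t)
  F-path-induction P Q closed Q₀ = <-weakInduction (Q ∘ vert) Q₀ λ i → closed (edge-F i) (edge-joins i)
    where open FPath P

  F-path-inside-closed-image : ∀ {N L v} (f : Fin N → Fin n) →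
    (∀ {e x y} → c e ≡ true → Joins (ends e) x y → InImage f x → InImage f y) →
    InImage f v → OnFPath G c L v → suc L ≤ N
  F-path-inside-closed-image {N} {L} f closed (t₀ , refl) (P , i₀ , vert-i₀) =
    injective⇒≤ {f = preimage} λ eq → vert-inj _ _ (trans (sym (proj₂ (inside _))) (trans (cong f eq) (proj₂ (inside _))))
    where
    open FPath P
    back-and-forth : ∀ t → (InImage f (vert t) → InImage f (vert fzero)) × (InImage f (vert fzero) → InImage f (vert t))
    back-and-forth = F-path-induction P (λ x → (InImage f x → InImage f (vert fzero)) × (InImage f (vert fzero) → InImage f x))
      (λ ce j (to , from) → (λ i → to (closed ce (joins-sym j) i)) , (λ i → closed ce j (from i)))
      (id , id)
    inside : ∀ t → InImage f (vert t)
    inside t = proj₂ (back-and-forth t) (proj₁ (back-and-forth i₀) (t₀ , sym vert-i₀))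
    preimage : Fin (suc L) → Fin N
    preimage t = proj₁ (inside t)

module ForestAdjacency (G : Graph) {k c} (F : KLinearForest G k c) where
  open Graph G
  open KLinearForest F

  At : Fin n → Fin p → ℕ → Set
  At x j a = Σ (Fin (suc (len j))) λ i → toℕ i ≡ a × vert j i ≡ x

  at-functional : ∀ {x y j a} → At x j a → At y j a → x ≡ y
  at-functional (i , refl , refl) (i′ , i′≡i , refl) with toℕ-injective i′≡i
  ... | refl = refl

  at-injective : ∀ {x j j′ a a′} → At x j a → At x j′ a′ → j ≡ j′ × a ≡ a′
  at-injective (i , refl , x≡) (i′ , refl , x≡′) = vert-inj _ i _ i′ (trans x≡ (sym x≡′))

  Adjacent : Fin n → Fin n → Set
  Adjacent x y = Σ (Fin p) λ j → Σ ℕ λ a → Σ ℕ λ b → At x j a × At y j b × Consecutive a b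

  adjacent-sym : ∀ {x y} → Adjacent x y → Adjacent y x
  adjacent-sym (j , a , b , x-at , y-at , a~b) = j , b , a , y-at , x-at , consecutive-sym a~b

  path-step : ∀ j i → Adjacent (vert j (inject₁ i)) (vert j (fsuc i))
  path-step j i = j , _ , _ , (inject₁ i , refl , refl) , (fsuc i , refl , refl) , inj₁ (cong suc (toℕ-inject₁ i))

  F-edge⇒adjacent : ∀ {e x y} → c e ≡ true → Joins (ends e) x y → Adjacent x y
  F-edge⇒adjacent {e} ce j with cover e ce
  ... | j₀ , i , refl with joins-both (edge-joins j₀ i) j
  ...   | inj₁ refl = path-step j₀ i
  ...   | inj₂ refl = adjacent-sym (path-step j₀ i)

  adjacent-position : ∀ {x y j a} → At x j a → Adjacent x y → Σ ℕ λ b → At y j b × Consecutive a b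
  adjacent-position x-at (j′ , a′ , b , x-at′ , y-at , a′~b) with at-injective x-at x-at′
  ... | refl , refl = b , y-at , a′~b

  no-triangle : ∀ {x y z} → Adjacent x y → Adjacent y z → ¬ Adjacent z x
  no-triangle (j , a , b , x-at , y-at , a~b) y~z z~x with adjacent-position y-at y~z
  ... | c′ , z-at , b~c with adjacent-position z-at z~x
  ...   | a′ , x-at′ , c~a′ with at-injective x-at x-at′
  ...     | _ , refl = no-consecutive-triangle a~b b~c c~a′

  no-square : ∀ {x y z w} → Adjacent x y → Adjacent y z → Adjacent z w → Adjacent w x → x ≢ z → y ≢ w → ⊥
  no-square (j , a , b , x-at , y-at , a~b) y~z z~w w~x x≢z y≢w with adjacent-position y-at y~z
  ... | c′ , z-at , b~c with adjacent-position z-at z~w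
  ...   | d , w-at , c~d with adjacent-position w-at w~x
  ...     | a′ , x-at′ , d~a′ with at-injective x-at x-at′
  ...       | _ , refl with consecutive-square a~b b~c c~d d~a′
  ...         | inj₁ refl = x≢z (at-functional x-at z-at)
  ...         | inj₂ refl = y≢w (at-functional y-at w-at)

  degree≤2 : ∀ {x y₁ y₂ y₃} → Adjacent x y₁ → Adjacent x y₂ → Adjacent x y₃ →
    y₁ ≢ y₂ → y₁ ≢ y₃ → y₂ ≢ y₃ → ⊥
  degree≤2 (j , a , b₁ , x-at , y₁-at , a~b₁) x~y₂ x~y₃ y₁≢y₂ y₁≢y₃ y₂≢y₃
    with adjacent-position x-at x~y₂ | adjacent-position x-at x~y₃
  ... | b₂ , y₂-at , a~b₂ | b₃ , y₃-at , a~b₃ with consecutive-three a~b₁ a~b₂ a~b₃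
  ...   | inj₁ refl        = y₁≢y₂ (at-functional y₁-at y₂-at)
  ...   | inj₂ (inj₁ refl) = y₁≢y₃ (at-functional y₁-at y₃-at)
  ...   | inj₂ (inj₂ refl) = y₂≢y₃ (at-functional y₂-at y₃-at)

  -- An F-path never leaves the forest path containing its first edge.
  F-path-length≤k : ∀ {L} → FPath G c L → L ≤ k
  F-path-length≤k {zero}  _ = z≤n
  F-path-length≤k {suc L} P = ≤-trans (s≤s⁻¹ (injective⇒≤ {f = position} position-injective)) (len≤k j₀)
    where
    module P = FPath P
    first-edge : Adjacent (P.vert fzero) (P.vert (fsuc fzero))
    first-edge = F-edge⇒adjacent (P.edge-F fzero) (P.edge-joins fzero)
    j₀ : Fin p
    j₀ = proj₁ first-edge
    OnPath₀ : Fin n → Set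
    OnPath₀ x = Σ ℕ (At x j₀)
    on-path₀ : ∀ t → OnPath₀ (P.vert t)
    on-path₀ = F-path-induction G P OnPath₀
      (λ ce j (a , x-at) → let (b , y-at , _) = adjacent-position x-at (F-edge⇒adjacent ce j) in b , y-at)
      (_ , proj₁ (proj₂ (proj₂ (proj₂ first-edge))))
    position : Fin (suc (suc L)) → Fin (suc (len j₀))
    position t = proj₁ (proj₂ (on-path₀ t))
    position-injective : ∀ {t t′} → position t ≡ position t′ → t ≡ t′
    position-injective {t} {t′} eq = P.vert-inj t t′
      (trans (sym (proj₂ (proj₂ (proj₂ (on-path₀ t))))) (trans (cong (vert j₀) eq) (proj₂ (proj₂ (proj₂ (on-path₀ t′))))))

joins? : ∀ {n} (p : Fin n × Fin n) x y → Dec (Joins p x y)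
joins? p x y = ≡-dec _≟ᶠ_ _≟ᶠ_ p (x , y) ⊎-dec ≡-dec _≟ᶠ_ _≟ᶠ_ p (y , x)

incident? : ∀ G e x → Dec (Incident G e x)
incident? G e x = (proj₁ (Graph.ends G e) ≟ᶠ x) ⊎-dec (proj₂ (Graph.ends G e) ≟ᶠ x)

record Embedding (H G : Graph) : Set where
  field
    vertex : Fin (Graph.n H) → Fin (Graph.n G)
    vertex-injective : ∀ {x y} → vertex x ≡ vertex y → x ≡ y
    edge : Fin (Graph.m H) → Fin (Graph.m G)
    edge-ends : ∀ g → Graph.ends G (edge g) ≡ map vertex vertex (Graph.ends H g)

  joins : ∀ {g x y} → Joins (Graph.ends H g) x y → Joins (Graph.ends G (edge g)) (vertex x) (vertex y)
  joins {g} (inj₁ eq) = inj₁ (trans (edge-ends g) (cong (map vertex vertex) eq))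
  joins {g} (inj₂ eq) = inj₂ (trans (edge-ends g) (cong (map vertex vertex) eq))

  incident : ∀ {g x} → Incident H g x → Incident G (edge g) (vertex x)
  incident {g} (inj₁ eq) = inj₁ (trans (cong proj₁ (edge-ends g)) (cong vertex eq))
  incident {g} (inj₂ eq) = inj₂ (trans (cong proj₂ (edge-ends g)) (cong vertex eq))

  edge-injective : ∀ {g g′} → edge g ≡ edge g′ → g ≡ g′
  edge-injective {g} {g′} eq = Graph.simple H g g′ (inj₁ (sym (cong₂ _,_
    (vertex-injective (cong proj₁ same-ends)) (vertex-injective (cong proj₂ same-ends)))))
    where
    same-ends : map vertex vertex (Graph.ends H g) ≡ map vertex vertex (Graph.ends H g′)
    same-ends = trans (sym (edge-ends g)) (trans (cong (Graph.ends G) eq) (edge-ends g′))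

-- The side conditions are decided on H, so for a concrete gadget they are discharged by evaluation.
module Obstructions {H G : Graph} {k} {c : Colouring G} (D : IsDecomposition G k c) (ι : Embedding H G) where
  open Embedding ι
  open Graph H using (ends)
  open ForestAdjacency G (proj₁ D)

  restricted : Colouring H
  restricted g = c (edge g)

  private
    adjacent : ∀ {g x y} → True (joins? (ends g) x y) → restricted g ≡ true → Adjacent (vertex x) (vertex y)
    adjacent j cg = F-edge⇒adjacent cg (joins (toWitness j))

    distinct : ∀ {x y} → True (¬? (x ≟ᶠ y)) → vertex x ≢ vertex y
    distinct x≢y = toWitness x≢y ∘ vertex-injective

  two-M-edges : ∀ g g′ x → {True (¬? (g ≟ᶠ g′))} → {True (incident? H g x)} → {True (incident? H g′ x)} →
    restricted g ≡ false → restricted g′ ≡ false → ⊥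
  two-M-edges g g′ x {g≢g′} {x∈g} {x∈g′} cg cg′ = proj₂ D (edge g) (edge g′) (toWitness g≢g′ ∘ edge-injective) cg cg′
    (vertex x) (incident (toWitness x∈g) , incident (toWitness x∈g′))

  three-F-edges : ∀ x y₁ y₂ y₃ g₁ g₂ g₃ →
    {j₁ : True (joins? (ends g₁) x y₁)} {j₂ : True (joins? (ends g₂) x y₂)} {j₃ : True (joins? (ends g₃) x y₃)} →
    {d₁₂ : True (¬? (y₁ ≟ᶠ y₂))} {d₁₃ : True (¬? (y₁ ≟ᶠ y₃))} {d₂₃ : True (¬? (y₂ ≟ᶠ y₃))} →
    restricted g₁ ≡ true → restricted g₂ ≡ true → restricted g₃ ≡ true → ⊥
  three-F-edges x y₁ y₂ y₃ g₁ g₂ g₃ {j₁} {j₂} {j₃} {d₁₂} {d₁₃} {d₂₃} c₁ c₂ c₃ =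
    degree≤2 (adjacent j₁ c₁) (adjacent j₂ c₂) (adjacent j₃ c₃) (distinct d₁₂) (distinct d₁₃) (distinct d₂₃)

  F-triangle : ∀ x y z g₁ g₂ g₃ →
    {j₁ : True (joins? (ends g₁) x y)} {j₂ : True (joins? (ends g₂) y z)} {j₃ : True (joins? (ends g₃) z x)} →
    restricted g₁ ≡ true → restricted g₂ ≡ true → restricted g₃ ≡ true → ⊥
  F-triangle x y z g₁ g₂ g₃ {j₁} {j₂} {j₃} c₁ c₂ c₃ = no-triangle (adjacent j₁ c₁) (adjacent j₂ c₂) (adjacent j₃ c₃)

  F-square : ∀ x y z w g₁ g₂ g₃ g₄ →
    {j₁ : True (joins? (ends g₁) x y)} {j₂ : True (joins? (ends g₂) y z)} →
    {j₃ : True (joins? (ends g₃) z w)} {j₄ : True (joins? (ends g₄) w x)} →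
    {d₁ : True (¬? (x ≟ᶠ z))} {d₂ : True (¬? (y ≟ᶠ w))} →
    restricted g₁ ≡ true → restricted g₂ ≡ true → restricted g₃ ≡ true → restricted g₄ ≡ true → ⊥
  F-square x y z w g₁ g₂ g₃ g₄ {j₁} {j₂} {j₃} {j₄} {d₁} {d₂} c₁ c₂ c₃ c₄ =
    no-square (adjacent j₁ c₁) (adjacent j₂ c₂) (adjacent j₃ c₃) (adjacent j₄ c₄) (distinct d₁) (distinct d₂)

  long-F-path : ∀ (vs : Vec (Fin (Graph.n H)) (suc (suc k))) (gs : Vec (Fin (Graph.m H)) (suc k)) →
    {distinct : True (all? λ i → all? λ j → (lookup vs i ≟ᶠ lookup vs j) →-dec (i ≟ᶠ j))} →
    {path : True (all? λ i → joins? (ends (lookup gs i)) (lookup vs (inject₁ i)) (lookup vs (fsuc i)))} →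
    All (λ g → restricted g ≡ true) gs → ⊥
  long-F-path vs gs {distinct} {path} F-edges = 1+n≰n (F-path-length≤k P)
    where
    P : FPath G c (suc k)
    P = record
      { vert = vertex ∘ lookup vs
      ; vert-inj = λ i j eq → toWitness distinct i j (vertex-injective eq)
      ; edge = edge ∘ lookup gs
      ; edge-joins = λ i → joins (toWitness path i)
      ; edge-F = lookup⁺ F-edges }

record Gadget (k : ℕ) : Set where
  field
    graph : Graph
  open Graph graph public
  open Segments
  field
    root tip : Fin n
    attachment : Fin m
    attachment-ends : ends attachment ≡ (root , tip)
    only-attachment-at-root : ∀ g → Incident graph g root → g ≡ attachment
    coord : Axis → Fin n → ℕ
    width : ℕ
    coord<width : ∀ u → coord horizontal u < width
    root-at-origin : ∀ ax → coord ax root ≡ 0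
    above-root : ∀ u → u ≢ root → 0 < coord vertical u
    coord-injective : ∀ u v → coord horizontal u ≡ coord horizontal v → coord vertical u ≡ coord vertical v → u ≡ v
    vertex-clear : ∀ w g → Incident graph g w ⊎ Off coord w (ends g)
    edges-clear : ∀ g g′ → g ≡ g′ ⊎ Apart coord (ends g) (ends g′)
    colour : Colouring graph
    forest : KLinearForest graph k colour
    matching : Matching graph colour
    forest-avoids-root : ∀ j i → KLinearForest.vert forest j i ≢ root
    attachment-forced : ∀ G c → IsDecomposition G k c → (ι : Embedding graph G) → c (Embedding.edge ι attachment) ≡ false

module Chain {k ℓ′ : ℕ} (Γ : Gadget k) (ℓ≤k : suc ℓ′ ≤ k) where
  private
    module Γ = Gadget Γ

  ℓ : ℕ
  ℓ = suc ℓ′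

  N : ℕ
  N = suc (ℓ * Γ.n)

  E : ℕ
  E = suc Γ.m

  M : ℕ
  M = ℓ * E

  copy : Fin ℓ → Fin Γ.n → Fin N
  copy i u = fsuc (combine i u)

  spine : Fin (suc ℓ) → Fin N
  spine fzero    = fzero
  spine (fsuc i) = copy i Γ.root

  link : Fin ℓ → Fin M
  link i = combine i fzero

  copy-edge : Fin ℓ → Fin Γ.m → Fin M
  copy-edge i g = combine i (fsuc g)

  data VertexView : Fin N → Set where
    start : VertexView fzero
    in-copy : ∀ i u → VertexView (copy i u)

  vertex-view : ∀ x → VertexView x
  vertex-view fzero = start
  vertex-view (fsuc y) with combine-surjective {ℓ} {Γ.n} y
  ... | i , u , refl = in-copy i u

  data EdgeView : Fin M → Set where
    linking : ∀ i → EdgeView (link i)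
    copied : ∀ i g → EdgeView (copy-edge i g)

  edge-view : ∀ e → EdgeView e
  edge-view e with combine-surjective {ℓ} {E} e
  ... | i , fzero , refl = linking i
  ... | i , fsuc g , refl = copied i g

  segment : Fin ℓ → Fin E → Fin N × Fin N
  segment i fzero    = (spine (inject₁ i) , spine (fsuc i))
  segment i (fsuc g) = map (copy i) (copy i) (Γ.ends g)

  ends : Fin M → Fin N × Fin N
  ends e = uncurry segment (remQuot E e)

  ends-combine : ∀ i u → ends (combine i u) ≡ segment i u
  ends-combine i u = cong (uncurry segment) (remQuot-combine i u)

  on-segments : (P : Fin M → Fin N × Fin N → Set) → (∀ i u → P (combine i u) (segment i u)) → ∀ e → P e (ends e)
  on-segments P P-segment e with combine-surjective {ℓ} {E} e
  ... | i , u , refl = subst (P _) (sym (ends-combine i u)) (P-segment i u)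

  copy-injective : ∀ {i j u u′} → copy i u ≡ copy j u′ → i ≡ j × u ≡ u′
  copy-injective eq = combine-injective _ _ _ _ (fsuc-injective eq)

  spine-injective : ∀ {t t′} → spine t ≡ spine t′ → t ≡ t′
  spine-injective {fzero}  {fzero}   _  = refl
  spine-injective {fsuc i} {fsuc i′} eq = cong fsuc (proj₁ (copy-injective {i} {i′} eq))

  spine-cong : ∀ {t t′} → toℕ t ≡ toℕ t′ → spine t ≡ spine t′
  spine-cong = cong spine ∘ toℕ-injective

  spine-in-copy : ∀ {t i u} → spine t ≡ copy i u → u ≡ Γ.root
  spine-in-copy {fsuc t} {i} eq = sym (proj₂ (copy-injective {t} {i} eq))

  loopless : ∀ e → proj₁ (ends e) ≢ proj₂ (ends e)
  loopless = on-segments (λ _ p → proj₁ p ≢ proj₂ p) segment-loopless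
    where
    segment-loopless : ∀ i u → proj₁ (segment i u) ≢ proj₂ (segment i u)
    segment-loopless i fzero    eq = 1+n≢n (trans (sym (cong toℕ (spine-injective eq))) (toℕ-inject₁ i))
    segment-loopless i (fsuc g) eq = Γ.loopless g (proj₂ (copy-injective {i} {i} eq))

  -- Copy i occupies the horizontal strip [W(i+1), W(i+2)), where W is the gadget width,
  -- and the spine vertex s_t sits at (W t, 0).
  offset : Axis → Fin ℓ → ℕ
  offset horizontal i = Γ.width * suc (toℕ i)
  offset vertical   _ = 0

  coord : Axis → Fin N → ℕ
  coord ax fzero    = 0
  coord ax (fsuc y) = uncurry (λ i u → offset ax i + Γ.coord ax u) (remQuot Γ.n y)

  coord-copy : ∀ ax i u → coord ax (copy i u) ≡ offset ax i + Γ.coord ax u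
  coord-copy ax i u = cong (uncurry (λ i u → offset ax i + Γ.coord ax u)) (remQuot-combine i u)

  open Segments coord

  module Lift (i : Fin ℓ) = Translation Γ.coord coord (copy i) (λ ax → offset ax i) (λ ax u → coord-copy ax i u)

  private
    W : ℕ
    W = Γ.width

    W*-< : ∀ {a b} → a < b → W * a < W * b
    W*-< = *-monoʳ-< W {{>-nonZero (≤-<-trans (≤-reflexive (sym (Γ.root-at-origin horizontal))) (Γ.coord<width Γ.root))}}

    copy-lower : ∀ i u → W * suc (toℕ i) ≤ coord horizontal (copy i u)
    copy-lower i u = ≤-trans (m≤m+n _ _) (≤-reflexive (sym (coord-copy horizontal i u)))

    copy-upper : ∀ i u → coord horizontal (copy i u) < W * suc (suc (toℕ i))
    copy-upper i u = begin-strict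
      coord horizontal (copy i u)            ≡⟨ coord-copy horizontal i u ⟩
      W * suc (toℕ i) + Γ.coord horizontal u <⟨ +-monoʳ-< (W * suc (toℕ i)) (Γ.coord<width u) ⟩
      W * suc (toℕ i) + W                    ≡⟨ +-comm _ W ⟩
      W + W * suc (toℕ i)                    ≡⟨ sym (*-suc W (suc (toℕ i))) ⟩
      W * suc (suc (toℕ i))                  ∎
      where open ≤-Reasoning

  spine-horizontal : ∀ t → coord horizontal (spine t) ≡ W * toℕ t
  spine-horizontal fzero    = sym (*-zeroʳ W)
  spine-horizontal (fsuc i) =
    trans (coord-copy horizontal i Γ.root) (trans (cong (_+_ (W * suc (toℕ i))) (Γ.root-at-origin horizontal)) (+-identityʳ _))

  spine-vertical : ∀ t → coord vertical (spine t) ≡ 0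
  spine-vertical fzero    = refl
  spine-vertical (fsuc i) = trans (coord-copy vertical i Γ.root) (Γ.root-at-origin vertical)

  spine-< : ∀ {t t′} → toℕ t < toℕ t′ → spine t <[ horizontal ] spine t′
  spine-< {t} {t′} lt = subst₂ _<_ (sym (spine-horizontal t)) (sym (spine-horizontal t′)) (W*-< lt)

  spine-≤ : ∀ {t t′} → toℕ t ≤ toℕ t′ → spine t ≤[ horizontal ] spine t′
  spine-≤ {t} {t′} le = subst₂ _≤_ (sym (spine-horizontal t)) (sym (spine-horizontal t′)) (*-monoʳ-≤ W le)

  spine-<-copy : ∀ t i u → toℕ t < suc (toℕ i) → spine t <[ horizontal ] copy i u
  spine-<-copy t i u lt = <-≤-trans (subst (_< _) (sym (spine-horizontal t)) (W*-< lt)) (copy-lower i u)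

  copy-<-spine : ∀ i u t → suc (toℕ i) < toℕ t → copy i u <[ horizontal ] spine t
  copy-<-spine i u t lt = <-≤-trans (copy-upper i u) (subst (_ ≤_) (sym (spine-horizontal t)) (*-monoʳ-≤ W lt))

  copy-<-copy : ∀ i u j v → toℕ i < toℕ j → copy i u <[ horizontal ] copy j v
  copy-<-copy i u j v lt = <-≤-trans (copy-upper i u) (≤-trans (*-monoʳ-≤ W (s≤s lt)) (copy-lower j v))

  spine-below-copy : ∀ t i {u} → u ≢ Γ.root → spine t <[ vertical ] copy i u
  spine-below-copy t i {u} u≢root =
    subst₂ _<_ (sym (spine-vertical t)) (sym (coord-copy vertical i u)) (Γ.above-root u u≢root)

  spine-lowest : ∀ t x → spine t ≤[ vertical ] x
  spine-lowest t x = subst (_≤ _) (sym (spine-vertical t)) z≤n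

  VertexClear : Fin N → Fin N × Fin N → Set
  VertexClear w p = Endpoint w p ⊎ Off w p

  spine-vertex-clear : ∀ t i → VertexClear (spine t) (segment i fzero)
  spine-vertex-clear t i with <-cmp (toℕ t) (toℕ i)
  ... | tri< t<i _ _ = inj₂ (horizontal , inj₁ (spine-< (subst (_ <_) (sym (toℕ-inject₁ i)) t<i) , spine-< (m<n⇒m<1+n t<i)))
  ... | tri≈ _ t≡i _ = inj₁ (inj₁ (spine-cong (trans (toℕ-inject₁ i) (sym t≡i))))
  ... | tri> _ _ i<t with suc (toℕ i) ≟ toℕ t
  ...   | yes i+1≡t = inj₁ (inj₂ (spine-cong i+1≡t))
  ...   | no  i+1≢t = inj₂ (horizontal , inj₂ (spine-< (subst (_< _) (sym (toℕ-inject₁ i)) i<t) , spine-< (≤∧≢⇒< i<t i+1≢t)))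

  link-vertex-clear : ∀ w i → VertexClear w (segment i fzero)
  link-vertex-clear w i with vertex-view w
  ... | start = spine-vertex-clear fzero i
  ... | in-copy j u with u ≟ᶠ Γ.root
  ...   | yes refl = spine-vertex-clear (fsuc j) i
  ...   | no u≢root = inj₂ (vertical , inj₂ (spine-below-copy (inject₁ i) j u≢root , spine-below-copy (fsuc i) j u≢root))

  copy-vertex-clear : ∀ w i g → VertexClear w (segment i (fsuc g))
  copy-vertex-clear w i g with vertex-view w
  ... | start = inj₂ (horizontal , inj₁ (spine-<-copy fzero i _ z<s , spine-<-copy fzero i _ z<s))
  ... | in-copy j u with <-cmp (toℕ j) (toℕ i)
  ...   | tri< j<i _ _ = inj₂ (horizontal , inj₁ (copy-<-copy j u i _ j<i , copy-<-copy j u i _ j<i))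
  ...   | tri> _ _ i<j = inj₂ (horizontal , inj₂ (copy-<-copy i _ j u i<j , copy-<-copy i _ j u i<j))
  ...   | tri≈ _ j≡i _ with toℕ-injective j≡i | Γ.vertex-clear u g
  ...     | refl | inj₁ (inj₁ eq) = inj₁ (inj₁ (cong (copy j) eq))
  ...     | refl | inj₁ (inj₂ eq) = inj₁ (inj₂ (cong (copy j) eq))
  ...     | refl | inj₂ off      = inj₂ (Lift.off-translate j off)

  vertex-clear : ∀ w e → VertexClear w (ends e)
  vertex-clear w = on-segments (λ _ → VertexClear w) segment-clear
    where
    segment-clear : ∀ i u → VertexClear w (segment i u)
    segment-clear i fzero    = link-vertex-clear w i
    segment-clear i (fsuc g) = copy-vertex-clear w i g

  private
    inject₁-< : ∀ {i : Fin ℓ} {a} → toℕ i < a → toℕ (inject₁ i) < a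
    inject₁-< {i} = subst (_< _) (sym (toℕ-inject₁ i))

    <-inject₁ : ∀ {a} {i : Fin ℓ} → a < toℕ i → a < toℕ (inject₁ i)
    <-inject₁ {i = i} = subst (_ <_) (sym (toℕ-inject₁ i))

    tip≢root : Γ.tip ≢ Γ.root
    tip≢root tip≡root = Γ.loopless Γ.attachment
      (trans (cong proj₁ Γ.attachment-ends) (sym (trans (cong proj₂ Γ.attachment-ends) tip≡root)))

  links-apart : ∀ i j → toℕ i < toℕ j → Apart (segment i fzero) (segment j fzero)
  links-apart i j i<j with suc (toℕ i) ≟ toℕ j
  ... | yes i+1≡j = inj₂ (spine (fsuc i) , spine (inject₁ i) , spine (fsuc j) , inj₂ refl ,
                          inj₁ (cong (_, spine (fsuc j)) (spine-cong (trans (toℕ-inject₁ j) (sym i+1≡j)))) ,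
                          horizontal , inj₁ (inj₂ (spine-< {inject₁ i} {fsuc i} (inject₁-< {i} ≤-refl) , spine-≤ {fsuc i} {fsuc j} (s≤s (<⇒≤ i<j)))))
  ... | no  i+1≢j = inj₁ (horizontal , inj₁
                          ((spine-< (inject₁-< (<-inject₁ i<j)) , spine-< (inject₁-< (m<n⇒m<1+n i<j))) ,
                           (spine-< (<-inject₁ (≤∧≢⇒< i<j i+1≢j)) , spine-< (s≤s i<j))))

  link-attachment-apart : ∀ i j → Apart (segment i fzero) (spine (fsuc j) , copy j Γ.tip)
  link-attachment-apart i j with <-cmp (toℕ j) (toℕ i)
  ... | tri≈ _ j≡i _ with refl ← toℕ-injective j≡i =
    inj₂ (spine (fsuc i) , spine (inject₁ i) , copy i Γ.tip , inj₂ refl , inj₁ refl ,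
          vertical , inj₂ (inj₁ (spine-below-copy (fsuc i) i tip≢root , spine-lowest (inject₁ i) _)))
  ... | tri> _ _ i<j = inj₁ (horizontal , inj₁
          ((spine-< (inject₁-< (s≤s (<⇒≤ i<j))) , spine-<-copy (inject₁ i) j Γ.tip (inject₁-< (m<n⇒m<1+n i<j))) ,
           (spine-< (s≤s i<j) , spine-<-copy (fsuc i) j Γ.tip (s≤s i<j))))
  ... | tri< j<i _ _ with suc (toℕ j) ≟ toℕ i
  ...   | yes j+1≡i = inj₂ (spine (fsuc j) , spine (fsuc i) , copy j Γ.tip ,
            inj₁ (cong (_, spine (fsuc i)) (spine-cong (trans (toℕ-inject₁ i) (sym j+1≡i)))) , inj₁ refl ,
            vertical , inj₂ (inj₁ (spine-below-copy (fsuc j) j tip≢root , spine-lowest (fsuc i) _)))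
  ...   | no  j+1≢i = inj₁ (horizontal , inj₂
            ((copy-<-spine j Γ.root (inject₁ i) j+1<i , copy-<-spine j Γ.root (fsuc i) (m<n⇒m<1+n (≤∧≢⇒< j<i j+1≢i))) ,
             (copy-<-spine j Γ.tip (inject₁ i) j+1<i , copy-<-spine j Γ.tip (fsuc i) (m<n⇒m<1+n (≤∧≢⇒< j<i j+1≢i)))))
    where
    j+1<i : suc (toℕ j) < toℕ (inject₁ i)
    j+1<i = <-inject₁ (≤∧≢⇒< j<i j+1≢i)

  link-copy-apart : ∀ i j g → Apart (segment i fzero) (segment j (fsuc g))
  link-copy-apart i j g with g ≟ᶠ Γ.attachment
  ... | yes refl = subst (λ p → Apart (segment i fzero) (map (copy j) (copy j) p)) (sym Γ.attachment-ends)
                     (link-attachment-apart i j)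
  ... | no g≢att = inj₁ (vertical , inj₁ ((spine-below-copy (inject₁ i) j end₁≢root , spine-below-copy (inject₁ i) j end₂≢root) ,
                                          (spine-below-copy (fsuc i) j end₁≢root , spine-below-copy (fsuc i) j end₂≢root)))
    where
    end₁≢root : proj₁ (Γ.ends g) ≢ Γ.root
    end₁≢root eq = g≢att (Γ.only-attachment-at-root g (inj₁ eq))
    end₂≢root : proj₂ (Γ.ends g) ≢ Γ.root
    end₂≢root eq = g≢att (Γ.only-attachment-at-root g (inj₂ eq))

  copies-apart : ∀ i g j g′ → combine i (fsuc g) ≡ combine j (fsuc g′) ⊎ Apart (segment i (fsuc g)) (segment j (fsuc g′))
  copies-apart i g j g′ with <-cmp (toℕ i) (toℕ j)
  ... | tri< i<j _ _ = inj₂ (inj₁ (horizontal , inj₁ ((copy-<-copy i _ j _ i<j , copy-<-copy i _ j _ i<j) ,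
                                                     (copy-<-copy i _ j _ i<j , copy-<-copy i _ j _ i<j))))
  ... | tri> _ _ j<i = inj₂ (inj₁ (horizontal , inj₂ ((copy-<-copy j _ i _ j<i , copy-<-copy j _ i _ j<i) ,
                                                     (copy-<-copy j _ i _ j<i , copy-<-copy j _ i _ j<i))))
  ... | tri≈ _ i≡j _ with refl ← toℕ-injective i≡j with Γ.edges-clear g g′
  ...   | inj₁ refl = inj₁ refl
  ...   | inj₂ g∥g′ = inj₂ (Lift.apart-translate i g∥g′)

  segments-clear : ∀ i u j u′ → combine i u ≡ combine j u′ ⊎ Apart (segment i u) (segment j u′)
  segments-clear i fzero j fzero with <-cmp (toℕ i) (toℕ j)
  ... | tri< i<j _ _ = inj₂ (links-apart i j i<j)
  ... | tri≈ _ i≡j _ = inj₁ (cong link (toℕ-injective i≡j))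
  ... | tri> _ _ j<i = inj₂ (apart-sym (links-apart j i j<i))
  segments-clear i fzero    j (fsuc g′) = inj₂ (link-copy-apart i j g′)
  segments-clear i (fsuc g) j fzero     = inj₂ (apart-sym (link-copy-apart j i g))
  segments-clear i (fsuc g) j (fsuc g′) = copies-apart i g j g′

  edges-clear : ∀ e f → e ≡ f ⊎ Apart (ends e) (ends f)
  edges-clear = on-segments (λ e p → ∀ f → e ≡ f ⊎ Apart p (ends f))
    λ i u → on-segments (λ f p′ → combine i u ≡ f ⊎ Apart (segment i u) p′) (segments-clear i u)

  coord-injective : ∀ x y → coord horizontal x ≡ coord horizontal y → coord vertical x ≡ coord vertical y → x ≡ y
  coord-injective x y same-h same-v with vertex-view x | vertex-view y
  ... | start       | start       = refl
  ... | start       | in-copy j v = ⊥-elim (<-irrefl same-h (spine-<-copy fzero j v z<s))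
  ... | in-copy i u | start       = ⊥-elim (<-irrefl (sym same-h) (spine-<-copy fzero i u z<s))
  ... | in-copy i u | in-copy j v with <-cmp (toℕ i) (toℕ j)
  ...   | tri< i<j _ _ = ⊥-elim (<-irrefl same-h (copy-<-copy i u j v i<j))
  ...   | tri> _ _ j<i = ⊥-elim (<-irrefl (sym same-h) (copy-<-copy j v i u j<i))
  ...   | tri≈ _ i≡j _ with refl ← toℕ-injective i≡j =
    cong (copy i) (Γ.coord-injective u v (in-block horizontal same-h) (in-block vertical same-v))
    where
    in-block : ∀ ax → coord ax (copy i u) ≡ coord ax (copy i v) → Γ.coord ax u ≡ Γ.coord ax v
    in-block ax eq = +-cancelˡ-≡ (offset ax i) _ _ (trans (sym (coord-copy ax i u)) (trans eq (coord-copy ax i v)))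

  graph : Graph
  graph = record { n = N ; m = M ; ends = ends ; loopless = loopless ; simple = simple-if-apart loopless edges-clear }

  planar : Planar graph
  planar = plane-drawing graph coord coord-injective vertex-clear edges-clear

  block : Fin ℓ → Embedding Γ.graph graph
  block i = record
    { vertex = copy i
    ; vertex-injective = λ eq → proj₂ (copy-injective {i} {i} eq)
    ; edge = copy-edge i
    ; edge-ends = λ g → ends-combine i (fsuc g) }

  incident-copy : ∀ {i g x} → Incident graph (copy-edge i g) x → Σ (Fin Γ.n) λ a → Incident Γ.graph g a × copy i a ≡ x
  incident-copy {i} {g} (inj₁ eq) = proj₁ (Γ.ends g) , inj₁ refl , trans (sym (cong proj₁ (ends-combine i (fsuc g)))) eq
  incident-copy {i} {g} (inj₂ eq) = proj₂ (Γ.ends g) , inj₂ refl , trans (sym (cong proj₂ (ends-combine i (fsuc g)))) eq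

  start-only-on-first-link : ∀ e → Incident graph e fzero → e ≡ link fzero
  start-only-on-first-link e e∋start with edge-view e
  ... | linking fzero = refl
  ... | copied i g with incident-copy {i} {g} e∋start
  ...   | _ , _ , ()
  start-only-on-first-link e (inj₁ eq) | linking (fsuc i) with () ← trans (sym (cong proj₁ (ends-combine (fsuc i) fzero))) eq
  start-only-on-first-link e (inj₂ eq) | linking (fsuc i) with () ← trans (sym (cong proj₂ (ends-combine (fsuc i) fzero))) eq

  segment-colour : Fin ℓ → Fin E → Bool
  segment-colour i fzero    = true
  segment-colour i (fsuc g) = Γ.colour g

  colouring : Colouring graph
  colouring e = uncurry segment-colour (remQuot E e)

  colouring-link : ∀ i → colouring (link i) ≡ true
  colouring-link i = cong (uncurry segment-colour) (remQuot-combine i fzero)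

  colouring-copy : ∀ i g → colouring (copy-edge i g) ≡ Γ.colour g
  colouring-copy i g = cong (uncurry segment-colour) (remQuot-combine i (fsuc g))

  private
    module ΓF = KLinearForest Γ.forest

    path-block : Fin (ℓ * ΓF.p) → Fin ℓ
    path-block z = proj₁ (remQuot {ℓ} ΓF.p z)

    path-local : Fin (ℓ * ΓF.p) → Fin ΓF.p
    path-local z = proj₂ (remQuot {ℓ} ΓF.p z)

    remQuot-injective : ∀ {z z′} → remQuot {ℓ} ΓF.p z ≡ remQuot ΓF.p z′ → z ≡ z′
    remQuot-injective {z} {z′} eq =
      trans (sym (combine-remQuot {ℓ} ΓF.p z)) (trans (cong (uncurry combine) eq) (combine-remQuot ΓF.p z′))

  -- Path 0 is the spine; path 1 + combine i r is the copy of the gadget's path r in block i.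
  forest : KLinearForest graph k colouring
  forest = record
    { p = suc (ℓ * ΓF.p) ; len = len ; len≤k = len≤k ; vert = vert ; vert-inj = vert-inj ; edge = edge
    ; edge-joins = edge-joins ; edge-F = edge-F ; cover = cover }
    where
    len : Fin (suc (ℓ * ΓF.p)) → ℕ
    len fzero    = ℓ
    len (fsuc z) = ΓF.len (path-local z)

    len≤k : ∀ j → len j ≤ k
    len≤k fzero    = ℓ≤k
    len≤k (fsuc z) = ΓF.len≤k (path-local z)

    vert : ∀ j → Fin (suc (len j)) → Fin N
    vert fzero    t = spine t
    vert (fsuc z) t = copy (path-block z) (ΓF.vert (path-local z) t)

    edge : ∀ j → Fin (len j) → Fin M
    edge fzero    t = link t
    edge (fsuc z) t = copy-edge (path-block z) (ΓF.edge (path-local z) t)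

    vert-inj : ∀ j t j′ t′ → vert j t ≡ vert j′ t′ → j ≡ j′ × toℕ t ≡ toℕ t′
    vert-inj fzero    t fzero     t′ eq = refl , cong toℕ (spine-injective eq)
    vert-inj fzero    t (fsuc z′) t′ eq = ⊥-elim (Γ.forest-avoids-root (path-local z′) t′ (spine-in-copy {t} {path-block z′} eq))
    vert-inj (fsuc z) t fzero     t′ eq = ⊥-elim (Γ.forest-avoids-root (path-local z) t (spine-in-copy {t′} {path-block z} (sym eq)))
    vert-inj (fsuc z) t (fsuc z′) t′ eq with copy-injective {path-block z} {path-block z′} eq
    ... | same-block , same-vertex with ΓF.vert-inj _ t _ t′ same-vertex
    ...   | same-path , same-position = cong fsuc (remQuot-injective {z} {z′} (cong₂ _,_ same-block same-path)) , same-position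

    edge-joins : ∀ j t → Joins (ends (edge j t)) (vert j (inject₁ t)) (vert j (fsuc t))
    edge-joins fzero    t = inj₁ (ends-combine t fzero)
    edge-joins (fsuc z) t = Embedding.joins (block (path-block z)) (ΓF.edge-joins (path-local z) t)

    edge-F : ∀ j t → colouring (edge j t) ≡ true
    edge-F fzero    t = colouring-link t
    edge-F (fsuc z) t = trans (colouring-copy (path-block z) _) (ΓF.edge-F (path-local z) t)

    copied-path : ∀ i r t → Σ (Fin (len (fsuc (combine i r)))) λ t′ → edge (fsuc (combine i r)) t′ ≡ copy-edge i (ΓF.edge r t)
    copied-path i r t = reindex (remQuot {ℓ} ΓF.p (combine i r)) (remQuot-combine i r)
      where
      reindex : ∀ q → q ≡ (i , r) → Σ (Fin (ΓF.len (proj₂ q))) λ t′ → copy-edge (proj₁ q) (ΓF.edge (proj₂ q) t′) ≡ copy-edge i (ΓF.edge r t)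
      reindex _ refl = t , refl

    cover : ∀ e → colouring e ≡ true → Σ (Fin (suc (ℓ * ΓF.p))) λ j → Σ (Fin (len j)) λ t → edge j t ≡ e
    cover e ce with edge-view e
    ... | linking i = fzero , i , refl
    ... | copied i g with ΓF.cover g (trans (sym (colouring-copy i g)) ce)
    ...   | r , t , refl = fsuc (combine i r) , copied-path i r t

  matching : Matching graph colouring
  matching e f e≢f ce cf x (x∈e , x∈f) with edge-view e | edge-view f
  ... | linking i   | _           = contradiction (trans (sym ce) (colouring-link i)) λ ()
  ... | copied _ _  | linking j   = contradiction (trans (sym cf) (colouring-link j)) λ ()
  ... | copied i g  | copied j g′ with incident-copy {i} {g} x∈e | incident-copy {j} {g′} x∈f
  ...   | a , a∈g , refl | a′ , a′∈g′ , same with copy-injective {i} {j} (sym same)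
  ...     | refl , refl = Γ.matching g g′ (e≢f ∘ cong (copy-edge i)) (trans (sym (colouring-copy i g)) ce)
                            (trans (sym (colouring-copy i g′)) cf) a (a∈g , a′∈g′)

  module _ {c : Colouring graph} (D : IsDecomposition graph k c) where

    links-in-F : ∀ i → c (link i) ≡ true
    links-in-F i with c (link i) in link-colour
    ... | true  = refl
    ... | false = ⊥-elim (proj₂ D (link i) (copy-edge i Γ.attachment) link≢copy link-colour
                    (Γ.attachment-forced graph c D (block i)) (spine (fsuc i))
                    (inj₂ (cong proj₂ (ends-combine i fzero)) ,
                     Embedding.incident (block i) (inj₁ (cong proj₁ Γ.attachment-ends))))
      where
      link≢copy : link i ≢ copy-edge i Γ.attachment
      link≢copy eq with () ← proj₂ (combine-injective i fzero i (fsuc Γ.attachment) eq)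

    on-spine : OnFPath graph c ℓ fzero
    on-spine = record
      { vert = spine ; vert-inj = λ _ _ → spine-injective ; edge = link
      ; edge-joins = λ t → inj₁ (ends-combine t fzero) ; edge-F = links-in-F } , fzero , refl

    -- An F-edge leaving the spine would lie in a copy and touch its root, so it would be the attachment.
    spine-F-closed : ∀ {e x y} → c e ≡ true → Joins (ends e) x y → InImage spine x → InImage spine y
    spine-F-closed {e} ce x~y (t , refl) with edge-view e
    ... | linking i with subst (λ p → Joins p _ _) (ends-combine i fzero) x~y
    ...   | inj₁ eq = fsuc i , ,-injectiveʳ eq
    ...   | inj₂ eq = inject₁ i , ,-injectiveˡ eq
    spine-F-closed {e} ce x~y (t , refl) | copied i g with incident-copy {i} {g} (joins⇒endpoint x~y)
    ...   | a , a∈g , a↦x with Γ.only-attachment-at-root g (subst (Incident Γ.graph g) (spine-in-copy {t} {i} (sym a↦x)) a∈g)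
    ...     | refl = contradiction (trans (sym ce) (Γ.attachment-forced graph c D (block i))) λ ()

    not-longer : ¬ OnFPath graph c (suc ℓ) fzero
    not-longer longer = 1+n≰n (F-path-inside-closed-image graph spine spine-F-closed (fzero , refl) longer)

  forcer : Forcer graph ℓ k fzero
  forcer = (link fzero , inj₁ (cong proj₁ (ends-combine fzero fzero)) , start-only-on-first-link) ,
           (colouring , forest , matching) ,
           λ c D → on-spine D , not-longer D

forest-mono : ∀ {G k k′} {c : Colouring G} → k ≤ k′ → KLinearForest G k c → KLinearForest G k′ c
forest-mono k≤k′ F = record
  { p = p ; len = len ; len≤k = λ j → ≤-trans (len≤k j) k≤k′ ; vert = vert ; vert-inj = vert-inj ; edge = edge
  ; edge-joins = edge-joins ; edge-F = edge-F ; cover = cover }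
  where open KLinearForest F

tabulated-graph : ∀ {n m} (ends : Vec (Fin n × Fin n) m) →
  {loopless : True (all? λ e → ¬? (proj₁ (lookup ends e) ≟ᶠ proj₂ (lookup ends e)))} →
  {simple : True (all? λ e → all? λ f → joins? (lookup ends f) (proj₁ (lookup ends e)) (proj₂ (lookup ends e)) →-dec (e ≟ᶠ f))} →
  Graph
tabulated-graph {n} {m} ends {loopless} {simple} = record
  { n = n ; m = m ; ends = lookup ends ; loopless = toWitness loopless ; simple = toWitness simple }

PathTable : ℕ → ℕ → Set
PathTable n m = Σ ℕ λ L → Vec (Fin n) (suc L) × Vec (Fin m) L

module _ (G : Graph) (c : Colouring G) {p : ℕ} (paths : Vec (PathTable (Graph.n G) (Graph.m G)) p) where
  open Graph G

  private
    len : Fin p → ℕ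
    len j = proj₁ (lookup paths j)

    vert : ∀ j → Fin (suc (len j)) → Fin n
    vert j = lookup (proj₁ (proj₂ (lookup paths j)))

    edge : ∀ j → Fin (len j) → Fin m
    edge j = lookup (proj₂ (proj₂ (lookup paths j)))

  tabulated-forest : ∀ k → {len≤k : True (all? λ j → len j ≤? k)} →
    {vert-inj : True (all? λ j → all? λ t → all? λ j′ → all? λ t′ →
                      (vert j t ≟ᶠ vert j′ t′) →-dec ((j ≟ᶠ j′) ×-dec (toℕ t ≟ toℕ t′)))} →
    {edge-joins : True (all? λ j → all? λ t → joins? (ends (edge j t)) (vert j (inject₁ t)) (vert j (fsuc t)))} →
    {edge-F : True (all? λ j → all? λ t → c (edge j t) Data.Bool.≟ true)} →
    {cover : True (all? λ e → (c e Data.Bool.≟ true) →-dec any? λ j → any? λ t → edge j t ≟ᶠ e)} →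
    KLinearForest G k c
  tabulated-forest k {len≤k} {vert-inj} {edge-joins} {edge-F} {cover} = record
    { p = p ; len = len ; len≤k = toWitness len≤k ; vert = vert ; vert-inj = toWitness vert-inj ; edge = edge
    ; edge-joins = toWitness edge-joins ; edge-F = toWitness edge-F ; cover = toWitness cover }

tabulated-coord : ∀ {n} → Vec ℕ n → Vec ℕ n → Axis → Fin n → ℕ
tabulated-coord xs ys horizontal = lookup xs
tabulated-coord xs ys vertical   = lookup ys

module _ {k} (H : Graph) (root tip : Fin (Graph.n H)) (attachment : Fin (Graph.m H))
  (coord : Axis → Fin (Graph.n H) → ℕ) (width : ℕ) (colour : Colouring H) (forest : KLinearForest H k colour) where
  open Graph H
  open Segments coord
  private
    module F = KLinearForest forest

  checked-gadget :
    (∀ G c → IsDecomposition G k c → (ι : Embedding H G) → c (Embedding.edge ι attachment) ≡ false) →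
    {attachment-ends : True (≡-dec _≟ᶠ_ _≟ᶠ_ (ends attachment) (root , tip))} →
    {only-attachment : True (all? λ g → incident? H g root →-dec (g ≟ᶠ attachment))} →
    {coord<width : True (all? λ u → coord horizontal u <? width)} →
    {root-at-origin : True (coord horizontal root ≟ 0 ×-dec coord vertical root ≟ 0)} →
    {above-root : True (all? λ u → ¬? (u ≟ᶠ root) →-dec (0 <? coord vertical u))} →
    {coord-injective : True (all? λ u → all? λ v →
                         (coord horizontal u ≟ coord horizontal v) →-dec ((coord vertical u ≟ coord vertical v) →-dec (u ≟ᶠ v)))} →
    {vertex-clear : True (all? λ w → all? λ g → incident? H g w ⊎-dec off? w (ends g))} →
    {edges-clear : True (all? λ g → all? λ g′ → (g ≟ᶠ g′) ⊎-dec apart? (ends g) (ends g′))} →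
    {matching : True (all? λ g → all? λ g′ → ¬? (g ≟ᶠ g′) →-dec ((colour g Data.Bool.≟ false) →-dec
                  ((colour g′ Data.Bool.≟ false) →-dec all? λ x → ¬? (incident? H g x ×-dec incident? H g′ x))))} →
    {avoids-root : True (all? λ j → all? λ t → ¬? (F.vert j t ≟ᶠ root))} →
    Gadget k
  checked-gadget forced {attachment-ends} {only-attachment} {coord<width} {root-at-origin} {above-root}
                 {coord-injective} {vertex-clear} {edges-clear} {matching} {avoids-root} = record
    { graph = H ; root = root ; tip = tip ; attachment = attachment
    ; attachment-ends = toWitness attachment-ends
    ; only-attachment-at-root = toWitness only-attachment
    ; coord = coord ; width = width
    ; coord<width = toWitness coord<width
    ; root-at-origin = λ { horizontal → proj₁ (toWitness root-at-origin) ; vertical → proj₂ (toWitness root-at-origin) }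
    ; above-root = toWitness above-root
    ; coord-injective = toWitness coord-injective
    ; vertex-clear = toWitness vertex-clear
    ; edges-clear = toWitness edges-clear
    ; colour = colour ; forest = forest
    ; matching = toWitness matching
    ; forest-avoids-root = toWitness avoids-root
    ; attachment-forced = forced }

module Gadget₃ where

  graph : Graph
  graph = tabulated-graph {8}
    ((# 0 , # 1) ∷ (# 1 , # 2) ∷ (# 2 , # 3) ∷ (# 2 , # 4) ∷ (# 3 , # 4) ∷ (# 3 , # 5) ∷ (# 5 , # 6) ∷
     (# 5 , # 7) ∷ (# 6 , # 7) ∷ [])

  coord : Axis → Fin 8 → ℕ
  coord = tabulated-coord (0 ∷ 0 ∷ 2 ∷ 4 ∷ 3 ∷ 4 ∷ 1 ∷ 3 ∷ []) (0 ∷ 1 ∷ 1 ∷ 1 ∷ 2 ∷ 4 ∷ 4 ∷ 3 ∷ [])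

  colour : Colouring graph
  colour = lookup (false ∷ true ∷ true ∷ false ∷ true ∷ false ∷ true ∷ true ∷ false ∷ [])

  forest : KLinearForest graph 3 colour
  forest = tabulated-forest graph colour
    ((3 , (# 1 ∷ # 2 ∷ # 3 ∷ # 4 ∷ []) , (# 1 ∷ # 2 ∷ # 4 ∷ []))
    ∷ (2 , (# 6 ∷ # 5 ∷ # 7 ∷ []) , (# 6 ∷ # 7 ∷ []))
    ∷ []) 3

  attachment-forced : ∀ G c → IsDecomposition G 3 c → (ι : Embedding graph G) → c (Embedding.edge ι (# 0)) ≡ false
  attachment-forced G c D ι = cases _ _ _ _ _ _ _ _ _ refl refl refl refl refl refl refl refl refl
    where
    open Obstructions D ι
    cases : ∀ (b0 b1 b2 b3 b4 b5 b6 b7 b8 : Bool) →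
      restricted (# 0) ≡ b0 → restricted (# 1) ≡ b1 → restricted (# 2) ≡ b2 → restricted (# 3) ≡ b3 → restricted (# 4) ≡ b4 →
      restricted (# 5) ≡ b5 → restricted (# 6) ≡ b6 → restricted (# 7) ≡ b7 → restricted (# 8) ≡ b8 →
      restricted (# 0) ≡ false
    cases true true true true _ _ _ _ _ _ e1 e2 e3 _ _ _ _ _ = ⊥-elim (three-F-edges (# 2) (# 1) (# 3) (# 4) (# 1) (# 2) (# 3) e1 e2 e3)
    cases true true true false true _ _ _ _ e0 e1 e2 _ e4 _ _ _ _ = ⊥-elim (long-F-path (# 0 ∷ # 1 ∷ # 2 ∷ # 3 ∷ # 4 ∷ []) (# 0 ∷ # 1 ∷ # 2 ∷ # 4 ∷ []) (e0 ∷ e1 ∷ e2 ∷ e4 ∷ []))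
    cases true true true false false _ _ _ _ _ _ _ e3 e4 _ _ _ _ = ⊥-elim (two-M-edges (# 3) (# 4) (# 4) e3 e4)
    cases true true false true true _ _ _ _ e0 e1 _ e3 e4 _ _ _ _ = ⊥-elim (long-F-path (# 0 ∷ # 1 ∷ # 2 ∷ # 4 ∷ # 3 ∷ []) (# 0 ∷ # 1 ∷ # 3 ∷ # 4 ∷ []) (e0 ∷ e1 ∷ e3 ∷ e4 ∷ []))
    cases true true false true false _ _ _ _ _ _ e2 _ e4 _ _ _ _ = ⊥-elim (two-M-edges (# 2) (# 4) (# 3) e2 e4)
    cases true true false false _ _ _ _ _ _ _ e2 e3 _ _ _ _ _ = ⊥-elim (two-M-edges (# 2) (# 3) (# 2) e2 e3)
    cases true false true true true _ _ _ _ _ _ e2 e3 e4 _ _ _ _ = ⊥-elim (F-triangle (# 2) (# 3) (# 4) (# 2) (# 4) (# 3) e2 e4 e3)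
    cases true false true true false true true _ _ _ _ e2 e3 _ e5 e6 _ _ = ⊥-elim (long-F-path (# 4 ∷ # 2 ∷ # 3 ∷ # 5 ∷ # 6 ∷ []) (# 3 ∷ # 2 ∷ # 5 ∷ # 6 ∷ []) (e3 ∷ e2 ∷ e5 ∷ e6 ∷ []))
    cases true false true true false true false true _ _ _ e2 e3 _ e5 _ e7 _ = ⊥-elim (long-F-path (# 4 ∷ # 2 ∷ # 3 ∷ # 5 ∷ # 7 ∷ []) (# 3 ∷ # 2 ∷ # 5 ∷ # 7 ∷ []) (e3 ∷ e2 ∷ e5 ∷ e7 ∷ []))
    cases true false true true false true false false _ _ _ _ _ _ _ e6 e7 _ = ⊥-elim (two-M-edges (# 6) (# 7) (# 5) e6 e7)
    cases true false true true false false _ _ _ _ _ _ _ e4 e5 _ _ _ = ⊥-elim (two-M-edges (# 4) (# 5) (# 3) e4 e5)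
    cases true false true false _ _ _ _ _ _ e1 _ e3 _ _ _ _ _ = ⊥-elim (two-M-edges (# 1) (# 3) (# 2) e1 e3)
    cases true false false _ _ _ _ _ _ _ e1 e2 _ _ _ _ _ _ = ⊥-elim (two-M-edges (# 1) (# 2) (# 2) e1 e2)
    cases false _ _ _ _ _ _ _ _ e0 _ _ _ _ _ _ _ _ = e0

  gadget : Gadget 3
  gadget = checked-gadget graph (# 0) (# 1) (# 0) coord 5 colour forest attachment-forced

module Gadget₄ where

  graph : Graph
  graph = tabulated-graph {6}
    ((# 0 , # 1) ∷ (# 1 , # 2) ∷ (# 2 , # 3) ∷ (# 2 , # 4) ∷ (# 3 , # 4) ∷ (# 3 , # 5) ∷ (# 4 , # 5) ∷ [])

  coord : Axis → Fin 6 → ℕ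
  coord = tabulated-coord (0 ∷ 0 ∷ 0 ∷ 2 ∷ 1 ∷ 3 ∷ []) (0 ∷ 1 ∷ 2 ∷ 2 ∷ 3 ∷ 3 ∷ [])

  colour : Colouring graph
  colour = lookup (false ∷ true ∷ false ∷ true ∷ true ∷ true ∷ false ∷ [])

  forest : KLinearForest graph 4 colour
  forest = tabulated-forest graph colour
    ((4 , (# 1 ∷ # 2 ∷ # 4 ∷ # 3 ∷ # 5 ∷ []) , (# 1 ∷ # 3 ∷ # 4 ∷ # 5 ∷ []))
    ∷ []) 4

  attachment-forced : ∀ G c → IsDecomposition G 4 c → (ι : Embedding graph G) → c (Embedding.edge ι (# 0)) ≡ false
  attachment-forced G c D ι = cases _ _ _ _ _ _ _ refl refl refl refl refl refl refl
    where
    open Obstructions D ι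
    cases : ∀ (b0 b1 b2 b3 b4 b5 b6 : Bool) →
      restricted (# 0) ≡ b0 → restricted (# 1) ≡ b1 → restricted (# 2) ≡ b2 → restricted (# 3) ≡ b3 → restricted (# 4) ≡ b4 →
      restricted (# 5) ≡ b5 → restricted (# 6) ≡ b6 →
      restricted (# 0) ≡ false
    cases true true true true _ _ _ _ e1 e2 e3 _ _ _ = ⊥-elim (three-F-edges (# 2) (# 1) (# 3) (# 4) (# 1) (# 2) (# 3) e1 e2 e3)
    cases true true true false true _ true e0 e1 e2 _ e4 _ e6 = ⊥-elim (long-F-path (# 0 ∷ # 1 ∷ # 2 ∷ # 3 ∷ # 4 ∷ # 5 ∷ []) (# 0 ∷ # 1 ∷ # 2 ∷ # 4 ∷ # 6 ∷ []) (e0 ∷ e1 ∷ e2 ∷ e4 ∷ e6 ∷ []))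
    cases true true true false true _ false _ _ _ e3 _ _ e6 = ⊥-elim (two-M-edges (# 3) (# 6) (# 4) e3 e6)
    cases true true true false false _ _ _ _ _ e3 e4 _ _ = ⊥-elim (two-M-edges (# 3) (# 4) (# 4) e3 e4)
    cases true true false true true true _ e0 e1 _ e3 e4 e5 _ = ⊥-elim (long-F-path (# 0 ∷ # 1 ∷ # 2 ∷ # 4 ∷ # 3 ∷ # 5 ∷ []) (# 0 ∷ # 1 ∷ # 3 ∷ # 4 ∷ # 5 ∷ []) (e0 ∷ e1 ∷ e3 ∷ e4 ∷ e5 ∷ []))
    cases true true false true true false _ _ _ e2 _ _ e5 _ = ⊥-elim (two-M-edges (# 2) (# 5) (# 3) e2 e5)
    cases true true false true false _ _ _ _ e2 _ e4 _ _ = ⊥-elim (two-M-edges (# 2) (# 4) (# 3) e2 e4)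
    cases true true false false _ _ _ _ _ e2 e3 _ _ _ = ⊥-elim (two-M-edges (# 2) (# 3) (# 2) e2 e3)
    cases true false true true true _ _ _ _ e2 e3 e4 _ _ = ⊥-elim (F-triangle (# 2) (# 3) (# 4) (# 2) (# 4) (# 3) e2 e4 e3)
    cases true false true true false true true _ _ e2 e3 _ e5 e6 = ⊥-elim (F-square (# 2) (# 3) (# 5) (# 4) (# 2) (# 5) (# 6) (# 3) e2 e5 e6 e3)
    cases true false true true false true false _ _ _ _ e4 _ e6 = ⊥-elim (two-M-edges (# 4) (# 6) (# 4) e4 e6)
    cases true false true true false false _ _ _ _ _ e4 e5 _ = ⊥-elim (two-M-edges (# 4) (# 5) (# 3) e4 e5)
    cases true false true false _ _ _ _ e1 _ e3 _ _ _ = ⊥-elim (two-M-edges (# 1) (# 3) (# 2) e1 e3)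
    cases true false false _ _ _ _ _ e1 e2 _ _ _ _ = ⊥-elim (two-M-edges (# 1) (# 2) (# 2) e1 e2)
    cases false _ _ _ _ _ _ e0 _ _ _ _ _ _ = e0

  gadget : Gadget 4
  gadget = checked-gadget graph (# 0) (# 1) (# 0) coord 4 colour forest attachment-forced

module Gadget₅ where

  graph : Graph
  graph = tabulated-graph {7}
    ((# 0 , # 1) ∷ (# 1 , # 2) ∷ (# 2 , # 3) ∷ (# 2 , # 4) ∷ (# 3 , # 4) ∷ (# 3 , # 5) ∷ (# 4 , # 5) ∷
     (# 5 , # 6) ∷ [])

  coord : Axis → Fin 7 → ℕ
  coord = tabulated-coord (0 ∷ 0 ∷ 1 ∷ 2 ∷ 3 ∷ 3 ∷ 0 ∷ []) (0 ∷ 2 ∷ 1 ∷ 2 ∷ 1 ∷ 3 ∷ 3 ∷ [])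

  colour : Colouring graph
  colour = lookup (false ∷ true ∷ false ∷ true ∷ true ∷ true ∷ false ∷ true ∷ [])

  forest : KLinearForest graph 5 colour
  forest = tabulated-forest graph colour
    ((5 , (# 1 ∷ # 2 ∷ # 4 ∷ # 3 ∷ # 5 ∷ # 6 ∷ []) , (# 1 ∷ # 3 ∷ # 4 ∷ # 5 ∷ # 7 ∷ []))
    ∷ []) 5

  attachment-forced : ∀ G c → IsDecomposition G 5 c → (ι : Embedding graph G) → c (Embedding.edge ι (# 0)) ≡ false
  attachment-forced G c D ι = cases _ _ _ _ _ _ _ _ refl refl refl refl refl refl refl refl
    where
    open Obstructions D ι
    cases : ∀ (b0 b1 b2 b3 b4 b5 b6 b7 : Bool) →
      restricted (# 0) ≡ b0 → restricted (# 1) ≡ b1 → restricted (# 2) ≡ b2 → restricted (# 3) ≡ b3 → restricted (# 4) ≡ b4 →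
      restricted (# 5) ≡ b5 → restricted (# 6) ≡ b6 → restricted (# 7) ≡ b7 →
      restricted (# 0) ≡ false
    cases true true true true _ _ _ _ _ e1 e2 e3 _ _ _ _ = ⊥-elim (three-F-edges (# 2) (# 1) (# 3) (# 4) (# 1) (# 2) (# 3) e1 e2 e3)
    cases true true true false true true _ _ _ _ e2 _ e4 e5 _ _ = ⊥-elim (three-F-edges (# 3) (# 2) (# 4) (# 5) (# 2) (# 4) (# 5) e2 e4 e5)
    cases true true true false true false true true e0 e1 e2 _ e4 _ e6 e7 = ⊥-elim (long-F-path (# 0 ∷ # 1 ∷ # 2 ∷ # 3 ∷ # 4 ∷ # 5 ∷ # 6 ∷ []) (# 0 ∷ # 1 ∷ # 2 ∷ # 4 ∷ # 6 ∷ # 7 ∷ []) (e0 ∷ e1 ∷ e2 ∷ e4 ∷ e6 ∷ e7 ∷ []))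
    cases true true true false true false true false _ _ _ _ _ e5 _ e7 = ⊥-elim (two-M-edges (# 5) (# 7) (# 5) e5 e7)
    cases true true true false true false false _ _ _ _ e3 _ _ e6 _ = ⊥-elim (two-M-edges (# 3) (# 6) (# 4) e3 e6)
    cases true true true false false _ _ _ _ _ _ e3 e4 _ _ _ = ⊥-elim (two-M-edges (# 3) (# 4) (# 4) e3 e4)
    cases true true false true true true true _ _ _ _ e3 e4 _ e6 _ = ⊥-elim (three-F-edges (# 4) (# 2) (# 3) (# 5) (# 3) (# 4) (# 6) e3 e4 e6)
    cases true true false true true true false true e0 e1 _ e3 e4 e5 _ e7 = ⊥-elim (long-F-path (# 0 ∷ # 1 ∷ # 2 ∷ # 4 ∷ # 3 ∷ # 5 ∷ # 6 ∷ []) (# 0 ∷ # 1 ∷ # 3 ∷ # 4 ∷ # 5 ∷ # 7 ∷ []) (e0 ∷ e1 ∷ e3 ∷ e4 ∷ e5 ∷ e7 ∷ []))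
    cases true true false true true true false false _ _ _ _ _ _ e6 e7 = ⊥-elim (two-M-edges (# 6) (# 7) (# 5) e6 e7)
    cases true true false true true false _ _ _ _ e2 _ _ e5 _ _ = ⊥-elim (two-M-edges (# 2) (# 5) (# 3) e2 e5)
    cases true true false true false _ _ _ _ _ e2 _ e4 _ _ _ = ⊥-elim (two-M-edges (# 2) (# 4) (# 3) e2 e4)
    cases true true false false _ _ _ _ _ _ e2 e3 _ _ _ _ = ⊥-elim (two-M-edges (# 2) (# 3) (# 2) e2 e3)
    cases true false true true true _ _ _ _ _ e2 e3 e4 _ _ _ = ⊥-elim (F-triangle (# 2) (# 3) (# 4) (# 2) (# 4) (# 3) e2 e4 e3)
    cases true false true true false true true _ _ _ e2 e3 _ e5 e6 _ = ⊥-elim (F-square (# 2) (# 3) (# 5) (# 4) (# 2) (# 5) (# 6) (# 3) e2 e5 e6 e3)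
    cases true false true true false true false _ _ _ _ _ e4 _ e6 _ = ⊥-elim (two-M-edges (# 4) (# 6) (# 4) e4 e6)
    cases true false true true false false _ _ _ _ _ _ e4 e5 _ _ = ⊥-elim (two-M-edges (# 4) (# 5) (# 3) e4 e5)
    cases true false true false _ _ _ _ _ e1 _ e3 _ _ _ _ = ⊥-elim (two-M-edges (# 1) (# 3) (# 2) e1 e3)
    cases true false false _ _ _ _ _ _ e1 e2 _ _ _ _ _ = ⊥-elim (two-M-edges (# 1) (# 2) (# 2) e1 e2)
    cases false _ _ _ _ _ _ _ e0 _ _ _ _ _ _ _ = e0

  gadget : Gadget 5
  gadget = checked-gadget graph (# 0) (# 1) (# 0) coord 4 colour forest attachment-forced

module Gadget₆ where

  graph : Graph
  graph = tabulated-graph {9}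
    ((# 0 , # 1) ∷ (# 1 , # 2) ∷ (# 2 , # 3) ∷ (# 2 , # 4) ∷ (# 3 , # 4) ∷ (# 3 , # 5) ∷ (# 4 , # 5) ∷
     (# 5 , # 6) ∷ (# 6 , # 7) ∷ (# 6 , # 8) ∷ [])

  coord : Axis → Fin 9 → ℕ
  coord = tabulated-coord (0 ∷ 0 ∷ 0 ∷ 2 ∷ 1 ∷ 3 ∷ 4 ∷ 4 ∷ 4 ∷ []) (0 ∷ 1 ∷ 4 ∷ 4 ∷ 2 ∷ 2 ∷ 3 ∷ 4 ∷ 1 ∷ [])

  colour : Colouring graph
  colour = lookup (false ∷ true ∷ false ∷ true ∷ true ∷ true ∷ false ∷ true ∷ false ∷ true ∷ [])

  forest : KLinearForest graph 6 colour
  forest = tabulated-forest graph colour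
    ((6 , (# 1 ∷ # 2 ∷ # 4 ∷ # 3 ∷ # 5 ∷ # 6 ∷ # 8 ∷ []) , (# 1 ∷ # 3 ∷ # 4 ∷ # 5 ∷ # 7 ∷ # 9 ∷ []))
    ∷ []) 6

  attachment-forced : ∀ G c → IsDecomposition G 6 c → (ι : Embedding graph G) → c (Embedding.edge ι (# 0)) ≡ false
  attachment-forced G c D ι = cases _ _ _ _ _ _ _ _ _ _ refl refl refl refl refl refl refl refl refl refl
    where
    open Obstructions D ι
    cases : ∀ (b0 b1 b2 b3 b4 b5 b6 b7 b8 b9 : Bool) →
      restricted (# 0) ≡ b0 → restricted (# 1) ≡ b1 → restricted (# 2) ≡ b2 → restricted (# 3) ≡ b3 → restricted (# 4) ≡ b4 →
      restricted (# 5) ≡ b5 → restricted (# 6) ≡ b6 → restricted (# 7) ≡ b7 → restricted (# 8) ≡ b8 → restricted (# 9) ≡ b9 →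
      restricted (# 0) ≡ false
    cases true true true true _ _ _ _ _ _ _ e1 e2 e3 _ _ _ _ _ _ = ⊥-elim (three-F-edges (# 2) (# 1) (# 3) (# 4) (# 1) (# 2) (# 3) e1 e2 e3)
    cases true true true false true true _ _ _ _ _ _ e2 _ e4 e5 _ _ _ _ = ⊥-elim (three-F-edges (# 3) (# 2) (# 4) (# 5) (# 2) (# 4) (# 5) e2 e4 e5)
    cases true true true false true false true true true _ e0 e1 e2 _ e4 _ e6 e7 e8 _ = ⊥-elim (long-F-path (# 0 ∷ # 1 ∷ # 2 ∷ # 3 ∷ # 4 ∷ # 5 ∷ # 6 ∷ # 7 ∷ []) (# 0 ∷ # 1 ∷ # 2 ∷ # 4 ∷ # 6 ∷ # 7 ∷ # 8 ∷ []) (e0 ∷ e1 ∷ e2 ∷ e4 ∷ e6 ∷ e7 ∷ e8 ∷ []))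
    cases true true true false true false true true false true e0 e1 e2 _ e4 _ e6 e7 _ e9 = ⊥-elim (long-F-path (# 0 ∷ # 1 ∷ # 2 ∷ # 3 ∷ # 4 ∷ # 5 ∷ # 6 ∷ # 8 ∷ []) (# 0 ∷ # 1 ∷ # 2 ∷ # 4 ∷ # 6 ∷ # 7 ∷ # 9 ∷ []) (e0 ∷ e1 ∷ e2 ∷ e4 ∷ e6 ∷ e7 ∷ e9 ∷ []))
    cases true true true false true false true true false false _ _ _ _ _ _ _ _ e8 e9 = ⊥-elim (two-M-edges (# 8) (# 9) (# 6) e8 e9)
    cases true true true false true false true false _ _ _ _ _ _ _ e5 _ e7 _ _ = ⊥-elim (two-M-edges (# 5) (# 7) (# 5) e5 e7)
    cases true true true false true false false _ _ _ _ _ _ e3 _ _ e6 _ _ _ = ⊥-elim (two-M-edges (# 3) (# 6) (# 4) e3 e6)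
    cases true true true false false _ _ _ _ _ _ _ _ e3 e4 _ _ _ _ _ = ⊥-elim (two-M-edges (# 3) (# 4) (# 4) e3 e4)
    cases true true false true true true true _ _ _ _ _ _ e3 e4 _ e6 _ _ _ = ⊥-elim (three-F-edges (# 4) (# 2) (# 3) (# 5) (# 3) (# 4) (# 6) e3 e4 e6)
    cases true true false true true true false true true _ e0 e1 _ e3 e4 e5 _ e7 e8 _ = ⊥-elim (long-F-path (# 0 ∷ # 1 ∷ # 2 ∷ # 4 ∷ # 3 ∷ # 5 ∷ # 6 ∷ # 7 ∷ []) (# 0 ∷ # 1 ∷ # 3 ∷ # 4 ∷ # 5 ∷ # 7 ∷ # 8 ∷ []) (e0 ∷ e1 ∷ e3 ∷ e4 ∷ e5 ∷ e7 ∷ e8 ∷ []))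
    cases true true false true true true false true false true e0 e1 _ e3 e4 e5 _ e7 _ e9 = ⊥-elim (long-F-path (# 0 ∷ # 1 ∷ # 2 ∷ # 4 ∷ # 3 ∷ # 5 ∷ # 6 ∷ # 8 ∷ []) (# 0 ∷ # 1 ∷ # 3 ∷ # 4 ∷ # 5 ∷ # 7 ∷ # 9 ∷ []) (e0 ∷ e1 ∷ e3 ∷ e4 ∷ e5 ∷ e7 ∷ e9 ∷ []))
    cases true true false true true true false true false false _ _ _ _ _ _ _ _ e8 e9 = ⊥-elim (two-M-edges (# 8) (# 9) (# 6) e8 e9)
    cases true true false true true true false false _ _ _ _ _ _ _ _ e6 e7 _ _ = ⊥-elim (two-M-edges (# 6) (# 7) (# 5) e6 e7)
    cases true true false true true false _ _ _ _ _ _ e2 _ _ e5 _ _ _ _ = ⊥-elim (two-M-edges (# 2) (# 5) (# 3) e2 e5)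
    cases true true false true false _ _ _ _ _ _ _ e2 _ e4 _ _ _ _ _ = ⊥-elim (two-M-edges (# 2) (# 4) (# 3) e2 e4)
    cases true true false false _ _ _ _ _ _ _ _ e2 e3 _ _ _ _ _ _ = ⊥-elim (two-M-edges (# 2) (# 3) (# 2) e2 e3)
    cases true false true true true _ _ _ _ _ _ _ e2 e3 e4 _ _ _ _ _ = ⊥-elim (F-triangle (# 2) (# 3) (# 4) (# 2) (# 4) (# 3) e2 e4 e3)
    cases true false true true false true true _ _ _ _ _ e2 e3 _ e5 e6 _ _ _ = ⊥-elim (F-square (# 2) (# 3) (# 5) (# 4) (# 2) (# 5) (# 6) (# 3) e2 e5 e6 e3)
    cases true false true true false true false _ _ _ _ _ _ _ e4 _ e6 _ _ _ = ⊥-elim (two-M-edges (# 4) (# 6) (# 4) e4 e6)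
    cases true false true true false false _ _ _ _ _ _ _ _ e4 e5 _ _ _ _ = ⊥-elim (two-M-edges (# 4) (# 5) (# 3) e4 e5)
    cases true false true false _ _ _ _ _ _ _ e1 _ e3 _ _ _ _ _ _ = ⊥-elim (two-M-edges (# 1) (# 3) (# 2) e1 e3)
    cases true false false _ _ _ _ _ _ _ _ e1 e2 _ _ _ _ _ _ _ = ⊥-elim (two-M-edges (# 1) (# 2) (# 2) e1 e2)
    cases false _ _ _ _ _ _ _ _ _ e0 _ _ _ _ _ _ _ _ _ = e0

  gadget : Gadget 6
  gadget = checked-gadget graph (# 0) (# 1) (# 0) coord 5 colour forest attachment-forced

module Gadget₇ where

  graph : Graph
  graph = tabulated-graph {13}
    ((# 0 , # 1) ∷ (# 1 , # 2) ∷ (# 2 , # 3) ∷ (# 2 , # 4) ∷ (# 3 , # 4) ∷ (# 3 , # 5) ∷ (# 4 , # 5) ∷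
     (# 5 , # 6) ∷ (# 6 , # 7) ∷ (# 6 , # 8) ∷ (# 7 , # 9) ∷ (# 7 , # 10) ∷ (# 8 , # 11) ∷ (# 8 , # 12) ∷ [])

  coord : Axis → Fin 13 → ℕ
  coord = tabulated-coord (0 ∷ 0 ∷ 0 ∷ 2 ∷ 1 ∷ 4 ∷ 4 ∷ 2 ∷ 5 ∷ 1 ∷ 1 ∷ 5 ∷ 5 ∷ []) (0 ∷ 3 ∷ 4 ∷ 4 ∷ 5 ∷ 5 ∷ 2 ∷ 2 ∷ 3 ∷ 3 ∷ 1 ∷ 5 ∷ 1 ∷ [])

  colour : Colouring graph
  colour = lookup (false ∷ true ∷ false ∷ true ∷ true ∷ true ∷ false ∷ true ∷ false ∷ true ∷ true ∷ true ∷ false ∷ true ∷ [])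

  forest : KLinearForest graph 7 colour
  forest = tabulated-forest graph colour
    ((7 , (# 1 ∷ # 2 ∷ # 4 ∷ # 3 ∷ # 5 ∷ # 6 ∷ # 8 ∷ # 12 ∷ []) , (# 1 ∷ # 3 ∷ # 4 ∷ # 5 ∷ # 7 ∷ # 9 ∷ # 13 ∷ []))
    ∷ (2 , (# 9 ∷ # 7 ∷ # 10 ∷ []) , (# 10 ∷ # 11 ∷ []))
    ∷ []) 7

  attachment-forced : ∀ G c → IsDecomposition G 7 c → (ι : Embedding graph G) → c (Embedding.edge ι (# 0)) ≡ false
  attachment-forced G c D ι = cases _ _ _ _ _ _ _ _ _ _ _ _ _ _ refl refl refl refl refl refl refl refl refl refl refl refl refl refl
    where
    open Obstructions D ι
    cases : ∀ (b0 b1 b2 b3 b4 b5 b6 b7 b8 b9 b10 b11 b12 b13 : Bool) →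
      restricted (# 0) ≡ b0 → restricted (# 1) ≡ b1 → restricted (# 2) ≡ b2 → restricted (# 3) ≡ b3 → restricted (# 4) ≡ b4 →
      restricted (# 5) ≡ b5 → restricted (# 6) ≡ b6 → restricted (# 7) ≡ b7 → restricted (# 8) ≡ b8 → restricted (# 9) ≡ b9 →
      restricted (# 10) ≡ b10 → restricted (# 11) ≡ b11 → restricted (# 12) ≡ b12 → restricted (# 13) ≡ b13 →
      restricted (# 0) ≡ false
    cases true true true true _ _ _ _ _ _ _ _ _ _ _ e1 e2 e3 _ _ _ _ _ _ _ _ _ _ = ⊥-elim (three-F-edges (# 2) (# 1) (# 3) (# 4) (# 1) (# 2) (# 3) e1 e2 e3)
    cases true true true false true true _ _ _ _ _ _ _ _ _ _ e2 _ e4 e5 _ _ _ _ _ _ _ _ = ⊥-elim (three-F-edges (# 3) (# 2) (# 4) (# 5) (# 2) (# 4) (# 5) e2 e4 e5)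
    cases true true true false true false true true true true _ _ _ _ _ _ _ _ _ _ _ e7 e8 e9 _ _ _ _ = ⊥-elim (three-F-edges (# 6) (# 5) (# 7) (# 8) (# 7) (# 8) (# 9) e7 e8 e9)
    cases true true true false true false true true true false true _ _ _ e0 e1 e2 _ e4 _ e6 e7 e8 _ e10 _ _ _ = ⊥-elim (long-F-path (# 0 ∷ # 1 ∷ # 2 ∷ # 3 ∷ # 4 ∷ # 5 ∷ # 6 ∷ # 7 ∷ # 9 ∷ []) (# 0 ∷ # 1 ∷ # 2 ∷ # 4 ∷ # 6 ∷ # 7 ∷ # 8 ∷ # 10 ∷ []) (e0 ∷ e1 ∷ e2 ∷ e4 ∷ e6 ∷ e7 ∷ e8 ∷ e10 ∷ []))
    cases true true true false true false true true true false false true _ _ e0 e1 e2 _ e4 _ e6 e7 e8 _ _ e11 _ _ = ⊥-elim (long-F-path (# 0 ∷ # 1 ∷ # 2 ∷ # 3 ∷ # 4 ∷ # 5 ∷ # 6 ∷ # 7 ∷ # 10 ∷ []) (# 0 ∷ # 1 ∷ # 2 ∷ # 4 ∷ # 6 ∷ # 7 ∷ # 8 ∷ # 11 ∷ []) (e0 ∷ e1 ∷ e2 ∷ e4 ∷ e6 ∷ e7 ∷ e8 ∷ e11 ∷ []))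
    cases true true true false true false true true true false false false _ _ _ _ _ _ _ _ _ _ _ _ e10 e11 _ _ = ⊥-elim (two-M-edges (# 10) (# 11) (# 7) e10 e11)
    cases true true true false true false true true false true true true true _ e0 e1 e2 _ e4 _ e6 e7 _ e9 _ _ e12 _ = ⊥-elim (long-F-path (# 0 ∷ # 1 ∷ # 2 ∷ # 3 ∷ # 4 ∷ # 5 ∷ # 6 ∷ # 8 ∷ # 11 ∷ []) (# 0 ∷ # 1 ∷ # 2 ∷ # 4 ∷ # 6 ∷ # 7 ∷ # 9 ∷ # 12 ∷ []) (e0 ∷ e1 ∷ e2 ∷ e4 ∷ e6 ∷ e7 ∷ e9 ∷ e12 ∷ []))
    cases true true true false true false true true false true true true false true e0 e1 e2 _ e4 _ e6 e7 _ e9 _ _ _ e13 = ⊥-elim (long-F-path (# 0 ∷ # 1 ∷ # 2 ∷ # 3 ∷ # 4 ∷ # 5 ∷ # 6 ∷ # 8 ∷ # 12 ∷ []) (# 0 ∷ # 1 ∷ # 2 ∷ # 4 ∷ # 6 ∷ # 7 ∷ # 9 ∷ # 13 ∷ []) (e0 ∷ e1 ∷ e2 ∷ e4 ∷ e6 ∷ e7 ∷ e9 ∷ e13 ∷ []))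
    cases true true true false true false true true false true true true false false _ _ _ _ _ _ _ _ _ _ _ _ e12 e13 = ⊥-elim (two-M-edges (# 12) (# 13) (# 8) e12 e13)
    cases true true true false true false true true false true true false _ _ _ _ _ _ _ _ _ _ e8 _ _ e11 _ _ = ⊥-elim (two-M-edges (# 8) (# 11) (# 7) e8 e11)
    cases true true true false true false true true false true false _ _ _ _ _ _ _ _ _ _ _ e8 _ e10 _ _ _ = ⊥-elim (two-M-edges (# 8) (# 10) (# 7) e8 e10)
    cases true true true false true false true true false false _ _ _ _ _ _ _ _ _ _ _ _ e8 e9 _ _ _ _ = ⊥-elim (two-M-edges (# 8) (# 9) (# 6) e8 e9)
    cases true true true false true false true false _ _ _ _ _ _ _ _ _ _ _ e5 _ e7 _ _ _ _ _ _ = ⊥-elim (two-M-edges (# 5) (# 7) (# 5) e5 e7)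
    cases true true true false true false false _ _ _ _ _ _ _ _ _ _ e3 _ _ e6 _ _ _ _ _ _ _ = ⊥-elim (two-M-edges (# 3) (# 6) (# 4) e3 e6)
    cases true true true false false _ _ _ _ _ _ _ _ _ _ _ _ e3 e4 _ _ _ _ _ _ _ _ _ = ⊥-elim (two-M-edges (# 3) (# 4) (# 4) e3 e4)
    cases true true false true true true true _ _ _ _ _ _ _ _ _ _ e3 e4 _ e6 _ _ _ _ _ _ _ = ⊥-elim (three-F-edges (# 4) (# 2) (# 3) (# 5) (# 3) (# 4) (# 6) e3 e4 e6)
    cases true true false true true true false true true true _ _ _ _ _ _ _ _ _ _ _ e7 e8 e9 _ _ _ _ = ⊥-elim (three-F-edges (# 6) (# 5) (# 7) (# 8) (# 7) (# 8) (# 9) e7 e8 e9)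
    cases true true false true true true false true true false true _ _ _ e0 e1 _ e3 e4 e5 _ e7 e8 _ e10 _ _ _ = ⊥-elim (long-F-path (# 0 ∷ # 1 ∷ # 2 ∷ # 4 ∷ # 3 ∷ # 5 ∷ # 6 ∷ # 7 ∷ # 9 ∷ []) (# 0 ∷ # 1 ∷ # 3 ∷ # 4 ∷ # 5 ∷ # 7 ∷ # 8 ∷ # 10 ∷ []) (e0 ∷ e1 ∷ e3 ∷ e4 ∷ e5 ∷ e7 ∷ e8 ∷ e10 ∷ []))
    cases true true false true true true false true true false false true _ _ e0 e1 _ e3 e4 e5 _ e7 e8 _ _ e11 _ _ = ⊥-elim (long-F-path (# 0 ∷ # 1 ∷ # 2 ∷ # 4 ∷ # 3 ∷ # 5 ∷ # 6 ∷ # 7 ∷ # 10 ∷ []) (# 0 ∷ # 1 ∷ # 3 ∷ # 4 ∷ # 5 ∷ # 7 ∷ # 8 ∷ # 11 ∷ []) (e0 ∷ e1 ∷ e3 ∷ e4 ∷ e5 ∷ e7 ∷ e8 ∷ e11 ∷ []))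
    cases true true false true true true false true true false false false _ _ _ _ _ _ _ _ _ _ _ _ e10 e11 _ _ = ⊥-elim (two-M-edges (# 10) (# 11) (# 7) e10 e11)
    cases true true false true true true false true false true true true true _ e0 e1 _ e3 e4 e5 _ e7 _ e9 _ _ e12 _ = ⊥-elim (long-F-path (# 0 ∷ # 1 ∷ # 2 ∷ # 4 ∷ # 3 ∷ # 5 ∷ # 6 ∷ # 8 ∷ # 11 ∷ []) (# 0 ∷ # 1 ∷ # 3 ∷ # 4 ∷ # 5 ∷ # 7 ∷ # 9 ∷ # 12 ∷ []) (e0 ∷ e1 ∷ e3 ∷ e4 ∷ e5 ∷ e7 ∷ e9 ∷ e12 ∷ []))
    cases true true false true true true false true false true true true false true e0 e1 _ e3 e4 e5 _ e7 _ e9 _ _ _ e13 = ⊥-elim (long-F-path (# 0 ∷ # 1 ∷ # 2 ∷ # 4 ∷ # 3 ∷ # 5 ∷ # 6 ∷ # 8 ∷ # 12 ∷ []) (# 0 ∷ # 1 ∷ # 3 ∷ # 4 ∷ # 5 ∷ # 7 ∷ # 9 ∷ # 13 ∷ []) (e0 ∷ e1 ∷ e3 ∷ e4 ∷ e5 ∷ e7 ∷ e9 ∷ e13 ∷ []))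
    cases true true false true true true false true false true true true false false _ _ _ _ _ _ _ _ _ _ _ _ e12 e13 = ⊥-elim (two-M-edges (# 12) (# 13) (# 8) e12 e13)
    cases true true false true true true false true false true true false _ _ _ _ _ _ _ _ _ _ e8 _ _ e11 _ _ = ⊥-elim (two-M-edges (# 8) (# 11) (# 7) e8 e11)
    cases true true false true true true false true false true false _ _ _ _ _ _ _ _ _ _ _ e8 _ e10 _ _ _ = ⊥-elim (two-M-edges (# 8) (# 10) (# 7) e8 e10)
    cases true true false true true true false true false false _ _ _ _ _ _ _ _ _ _ _ _ e8 e9 _ _ _ _ = ⊥-elim (two-M-edges (# 8) (# 9) (# 6) e8 e9)
    cases true true false true true true false false _ _ _ _ _ _ _ _ _ _ _ _ e6 e7 _ _ _ _ _ _ = ⊥-elim (two-M-edges (# 6) (# 7) (# 5) e6 e7)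
    cases true true false true true false _ _ _ _ _ _ _ _ _ _ e2 _ _ e5 _ _ _ _ _ _ _ _ = ⊥-elim (two-M-edges (# 2) (# 5) (# 3) e2 e5)
    cases true true false true false _ _ _ _ _ _ _ _ _ _ _ e2 _ e4 _ _ _ _ _ _ _ _ _ = ⊥-elim (two-M-edges (# 2) (# 4) (# 3) e2 e4)
    cases true true false false _ _ _ _ _ _ _ _ _ _ _ _ e2 e3 _ _ _ _ _ _ _ _ _ _ = ⊥-elim (two-M-edges (# 2) (# 3) (# 2) e2 e3)
    cases true false true true true _ _ _ _ _ _ _ _ _ _ _ e2 e3 e4 _ _ _ _ _ _ _ _ _ = ⊥-elim (F-triangle (# 2) (# 3) (# 4) (# 2) (# 4) (# 3) e2 e4 e3)
    cases true false true true false true true _ _ _ _ _ _ _ _ _ e2 e3 _ e5 e6 _ _ _ _ _ _ _ = ⊥-elim (F-square (# 2) (# 3) (# 5) (# 4) (# 2) (# 5) (# 6) (# 3) e2 e5 e6 e3)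
    cases true false true true false true false _ _ _ _ _ _ _ _ _ _ _ e4 _ e6 _ _ _ _ _ _ _ = ⊥-elim (two-M-edges (# 4) (# 6) (# 4) e4 e6)
    cases true false true true false false _ _ _ _ _ _ _ _ _ _ _ _ e4 e5 _ _ _ _ _ _ _ _ = ⊥-elim (two-M-edges (# 4) (# 5) (# 3) e4 e5)
    cases true false true false _ _ _ _ _ _ _ _ _ _ _ e1 _ e3 _ _ _ _ _ _ _ _ _ _ = ⊥-elim (two-M-edges (# 1) (# 3) (# 2) e1 e3)
    cases true false false _ _ _ _ _ _ _ _ _ _ _ _ e1 e2 _ _ _ _ _ _ _ _ _ _ _ = ⊥-elim (two-M-edges (# 1) (# 2) (# 2) e1 e2)
    cases false _ _ _ _ _ _ _ _ _ _ _ _ _ e0 _ _ _ _ _ _ _ _ _ _ _ _ _ = e0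

  gadget : Gadget 7
  gadget = checked-gadget graph (# 0) (# 1) (# 0) coord 6 colour forest attachment-forced

module Gadget₈ where

  graph : Graph
  graph = tabulated-graph {10}
    ((# 0 , # 1) ∷ (# 1 , # 2) ∷ (# 2 , # 3) ∷ (# 2 , # 4) ∷ (# 3 , # 4) ∷ (# 3 , # 5) ∷ (# 4 , # 5) ∷
     (# 1 , # 6) ∷ (# 6 , # 7) ∷ (# 6 , # 8) ∷ (# 7 , # 8) ∷ (# 7 , # 9) ∷ (# 8 , # 9) ∷ [])

  coord : Axis → Fin 10 → ℕ
  coord = tabulated-coord (0 ∷ 0 ∷ 1 ∷ 3 ∷ 2 ∷ 4 ∷ 0 ∷ 1 ∷ 3 ∷ 4 ∷ []) (0 ∷ 2 ∷ 1 ∷ 1 ∷ 2 ∷ 2 ∷ 4 ∷ 3 ∷ 4 ∷ 3 ∷ [])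

  colour : Colouring graph
  colour = lookup (false ∷ true ∷ false ∷ true ∷ true ∷ true ∷ false ∷ true ∷ false ∷ true ∷ true ∷ true ∷ false ∷ [])

  forest : KLinearForest graph 8 colour
  forest = tabulated-forest graph colour
    ((8 , (# 5 ∷ # 3 ∷ # 4 ∷ # 2 ∷ # 1 ∷ # 6 ∷ # 8 ∷ # 7 ∷ # 9 ∷ []) , (# 5 ∷ # 4 ∷ # 3 ∷ # 1 ∷ # 7 ∷ # 9 ∷ # 10 ∷ # 11 ∷ []))
    ∷ []) 8

  attachment-forced : ∀ {k} G c → IsDecomposition G k c → (ι : Embedding graph G) → c (Embedding.edge ι (# 0)) ≡ false
  attachment-forced G c D ι = cases _ _ _ _ _ _ _ _ _ _ _ _ _ refl refl refl refl refl refl refl refl refl refl refl refl refl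
    where
    open Obstructions D ι
    cases : ∀ (b0 b1 b2 b3 b4 b5 b6 b7 b8 b9 b10 b11 b12 : Bool) →
      restricted (# 0) ≡ b0 → restricted (# 1) ≡ b1 → restricted (# 2) ≡ b2 → restricted (# 3) ≡ b3 → restricted (# 4) ≡ b4 →
      restricted (# 5) ≡ b5 → restricted (# 6) ≡ b6 → restricted (# 7) ≡ b7 → restricted (# 8) ≡ b8 → restricted (# 9) ≡ b9 →
      restricted (# 10) ≡ b10 → restricted (# 11) ≡ b11 → restricted (# 12) ≡ b12 →
      restricted (# 0) ≡ false
    cases true true _ _ _ _ _ true _ _ _ _ _ e0 e1 _ _ _ _ _ e7 _ _ _ _ _ = ⊥-elim (three-F-edges (# 1) (# 0) (# 2) (# 6) (# 0) (# 1) (# 7) e0 e1 e7)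
    cases true true _ _ _ _ _ false true true true _ _ _ _ _ _ _ _ _ _ e8 e9 e10 _ _ = ⊥-elim (F-triangle (# 6) (# 7) (# 8) (# 8) (# 10) (# 9) e8 e10 e9)
    cases true true _ _ _ _ _ false true true false true true _ _ _ _ _ _ _ _ e8 e9 _ e11 e12 = ⊥-elim (F-square (# 6) (# 7) (# 9) (# 8) (# 8) (# 11) (# 12) (# 9) e8 e11 e12 e9)
    cases true true _ _ _ _ _ false true true false true false _ _ _ _ _ _ _ _ _ _ e10 _ e12 = ⊥-elim (two-M-edges (# 10) (# 12) (# 8) e10 e12)
    cases true true _ _ _ _ _ false true true false false _ _ _ _ _ _ _ _ _ _ _ e10 e11 _ = ⊥-elim (two-M-edges (# 10) (# 11) (# 7) e10 e11)
    cases true true _ _ _ _ _ false true false _ _ _ _ _ _ _ _ _ _ e7 _ e9 _ _ _ = ⊥-elim (two-M-edges (# 7) (# 9) (# 6) e7 e9)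
    cases true true _ _ _ _ _ false false _ _ _ _ _ _ _ _ _ _ _ e7 e8 _ _ _ _ = ⊥-elim (two-M-edges (# 7) (# 8) (# 6) e7 e8)
    cases true false true true true _ _ _ _ _ _ _ _ _ _ e2 e3 e4 _ _ _ _ _ _ _ _ = ⊥-elim (F-triangle (# 2) (# 3) (# 4) (# 2) (# 4) (# 3) e2 e4 e3)
    cases true false true true false true true _ _ _ _ _ _ _ _ e2 e3 _ e5 e6 _ _ _ _ _ _ = ⊥-elim (F-square (# 2) (# 3) (# 5) (# 4) (# 2) (# 5) (# 6) (# 3) e2 e5 e6 e3)
    cases true false true true false true false _ _ _ _ _ _ _ _ _ _ e4 _ e6 _ _ _ _ _ _ = ⊥-elim (two-M-edges (# 4) (# 6) (# 4) e4 e6)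
    cases true false true true false false _ _ _ _ _ _ _ _ _ _ _ e4 e5 _ _ _ _ _ _ _ = ⊥-elim (two-M-edges (# 4) (# 5) (# 3) e4 e5)
    cases true false true false _ _ _ _ _ _ _ _ _ _ e1 _ e3 _ _ _ _ _ _ _ _ _ = ⊥-elim (two-M-edges (# 1) (# 3) (# 2) e1 e3)
    cases true false false _ _ _ _ _ _ _ _ _ _ _ e1 e2 _ _ _ _ _ _ _ _ _ _ = ⊥-elim (two-M-edges (# 1) (# 2) (# 2) e1 e2)
    cases false _ _ _ _ _ _ _ _ _ _ _ _ e0 _ _ _ _ _ _ _ _ _ _ _ _ = e0

  gadget : ∀ {k} → 8 ≤ k → Gadget k
  gadget 8≤k = checked-gadget graph (# 0) (# 1) (# 0) coord 5 colour (forest-mono 8≤k forest) attachment-forced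

gadget : ∀ k → 3 ≤ k → Gadget k
gadget 1 (s≤s ())
gadget 2 (s≤s (s≤s ()))
gadget 3 _ = Gadget₃.gadget
gadget 4 _ = Gadget₄.gadget
gadget 5 _ = Gadget₅.gadget
gadget 6 _ = Gadget₆.gadget
gadget 7 _ = Gadget₇.gadget
gadget (suc (suc (suc (suc (suc (suc (suc (suc k)))))))) _ = Gadget₈.gadget (m≤m+n 8 k)

proposition2p5 : (k ℓ : ℕ) → 3 ≤ k → 1 ≤ ℓ → ℓ ≤ k →
    Σ Graph λ G → Σ (Fin (Graph.n G)) λ v → Forcer G ℓ k v × Planar G
proposition2p5 k (suc ℓ′) 3≤k _ ℓ≤k = graph , fzero , forcer , planar
  where open Chain (gadget k 3≤k) ℓ≤k
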